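{- For every $n\ge 0$, the Hankel determinant $H_{n}(\widetilde{\alpha}_{k}(x))$ is a polynomial in $x$ of degree $\frac{n(n+1)}{2}$ with leading coefficient \begin{equation*} \big[x^{\frac{n(n+1)}{2}}\big]H_{n}(\widetilde{\alpha}_{k}(x))=\alpha_{0}\alpha_{1}\cdots \alpha_{n}(-1)^{\binom{n+1}{2}}q^{2\binom{n+1}{3}}\prod_{j=1}^{n}(1-q^{j})^{n+1-j}. \end{equation*}
   Context: For a sequence $(a_k)_{k\ge0}$, $H_n(a_k):=\det_{0\le i,j\le n}(a_{i+j})$ denotes its $n$-th Hankel determinant. The $q$-Pochhammer symbol is $(A;q)_N:=\prod_{k=0}^{N-1}(1-Aq^k)$, and the $q$-binomial coefficient is $\genfrac{[}{]}{0pt}{}{n}{k}_q:=\frac{(q;q)_n}{(q;q)_k(q;q)_{n-k}}$ for $0\le k\le n$ and $0$ otherwise. Let $(\alpha_k)_{k\ge0}$ be an arbitrary sequence and define the polynomials \begin{align*} \widetilde{\alpha}_{k}(x):=\sum_{\ell=0}^{k}q^{\binom{\ell}{2}}\genfrac{[}{]}{0pt}{}{k}{\ell}_{q}\alpha_{\ell}x^{k-\ell}. \end{align*} -}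

module Defs where

open import Level using (Level)
open import Data.Nat as ℕ using (ℕ; zero; suc; _∸_; _≤ᵇ_)
open import Data.Nat.DivMod using (_/_)
open import Data.Nat.Combinatorics using (_C_)
open import Data.Bool using (if_then_else_)
open import Data.Fin using (Fin; zero; suc; punchIn; toℕ)
open import Algebra.Bundles using (CommutativeRing)

module Det {a} {A : Set a} (0A 1A : A) (_⊕_ _⊗_ : A → A → A) (⊖_ : A → A) where

  sumFin : ∀ n → (Fin n → A) → A
  sumFin zero    f = 0A
  sumFin (suc n) f = f zero ⊕ sumFin n (λ i → f (suc i))

  sign : ℕ → A → A
  sign zero    x = x
  sign (suc k) x = ⊖ (sign k x)

  det : ∀ n → (Fin n → Fin n → A) → A
  det zero    M = 1A
  det (suc n) M =
    sumFin (suc n) (λ j → sign (toℕ j)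
      (M zero j ⊗ det n (λ i k → M (suc i) (punchIn j k))))

  hankel : (ℕ → A) → ℕ → A
  hankel a n = det (suc n) (λ i j → a (toℕ i ℕ.+ toℕ j))

module _ {c ℓ : Level} (R : CommutativeRing c ℓ) where
  open CommutativeRing R

  sumTo : ℕ → (ℕ → Carrier) → Carrier
  sumTo zero    f = 0#
  sumTo (suc n) f = sumTo n f + f n

  prodTo : ℕ → (ℕ → Carrier) → Carrier
  prodTo zero    f = 1#
  prodTo (suc n) f = prodTo n f * f n

  pow : Carrier → ℕ → Carrier
  pow x zero    = 1#
  pow x (suc k) = pow x k * x

  -- Gaussian binomial coefficient [n k]_q, defined by the q-Pascal rule
  -- [n+1 k+1]_q = [n k]_q + q^(k+1) [n k+1]_q  (equals the Pochhammer ratio).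
  qbinom : Carrier → ℕ → ℕ → Carrier
  qbinom q zero    zero    = 1#
  qbinom q zero    (suc k) = 0#
  qbinom q (suc n) zero    = 1#
  qbinom q (suc n) (suc k) = qbinom q n k + pow q (suc k) * qbinom q n (suc k)

  -- Polynomials in x over R, as coefficient sequences: p m = [x^m] p.
  Poly : Set c
  Poly = ℕ → Carrier

  0P 1P : Poly
  0P m = 0#
  1P zero    = 1#
  1P (suc m) = 0#

  _+P_ _*P_ : Poly → Poly → Poly
  (f +P g) m = f m + g m
  (f *P g) m = sumTo (suc m) (λ i → f i * g (m ∸ i))

  -P_ : Poly → Poly
  (-P f) m = - f m

  mono : Carrier → ℕ → Poly
  mono a d m = if d ℕ.≡ᵇ m then a else 0#

  alphaTilde : Carrier → (ℕ → Carrier) → ℕ → Poly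
  alphaTilde q α k m =
    sumTo (suc k) (λ l → mono (pow q (l C 2) * qbinom q k l * α l) (k ∸ l) m)

  hankelPoly : Carrier → (ℕ → Carrier) → ℕ → Poly
  hankelPoly q α n = Det.hankel 0P 1P _+P_ _*P_ -P_ (alphaTilde q α) n

  leadCoeff : Carrier → (ℕ → Carrier) → ℕ → Carrier
  leadCoeff q α n =
    prodTo (suc n) α
    * pow (- 1#) (suc n C 2)
    * pow q (2 ℕ.* (suc n C 3))
    * prodTo n (λ i → pow (1# - pow q (suc i)) (suc n ∸ suc i))

  tri : ℕ → ℕ
  tri n = (n ℕ.* suc n) / 2

-- Over the polynomial ring, the Hankel matrix factors as L · U: by the q-Vandermonde
-- convolution, α̃_{i+j}(x) = Σ_a L_{ia} U_{aj} with the lower triangular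
-- L_{ia} = q^(a choose 2) [i a]_q x^(i-a) and U_{aj} = Σ_t q^(ja) q^(t choose 2) [j t]_q α_{a+t} x^(j-t).
-- So H_n is the constant ∏_i q^(i choose 2) = q^(n+1 choose 3) times det U. Column j of U has
-- degree at most j, hence det U has degree at most n(n+1)/2, and its coefficient there is
-- det(q^(ja) α_a) = α_0 ⋯ α_n times a q-Vandermonde determinant, evaluated by taking row
-- differences.
module Submission where

open import Defs
open import Level using (Level)
open import Data.Nat as ℕ using (ℕ; zero; suc; _∸_; _<_)
import Data.Nat.Properties as ℕ
open import Data.Nat.Combinatorics using (_C_; nC1≡n; nCk+nC[k+1]≡[n+1]C[k+1])
open import Data.Nat.DivMod using (_/_; m*n/n≡m)
open import Data.Nat.Tactic.RingSolver using (solve-∀)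
open import Data.Fin as Fin using (Fin; zero; suc; punchIn; toℕ)
import Data.Fin.Properties as Fin
open import Data.Bool using (true; false; if_then_else_)
open import Data.Empty using (⊥-elim)
open import Data.Product using (_×_; _,_)
open import Data.Sum using (inj₁; inj₂)
open import Function using (_∘_)
open import Relation.Binary.Definitions using (tri<; tri≈; tri>)
open import Relation.Binary.PropositionalEquality as ≡ using (_≡_; _≢_)
open import Relation.Nullary using (does; yes; no)
open import Relation.Nullary.Decidable using (dec-true; dec-false)
open import Algebra.Bundles using (CommutativeRing)
open import Algebra.Properties.CommutativeMonoid.Sum ℕ.+-0-commutativeMonoid
  using () renaming (sum to sumℕ; sum-remove to sumℕ-remove; sum-init-last to sumℕ-init-last; sum-cong-≗ to sumℕ-cong-≗)

module Determinant {c ℓ : Level} (R : CommutativeRing c ℓ) where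
  open CommutativeRing R hiding (zero)
  open import Algebra.Properties.Ring ring using (-0#≈0#; -‿+-comm; -‿distribʳ-*; +-inverseʳ-unique)
  open import Algebra.Properties.CommutativeSemigroup *-commutativeSemigroup using (x∙yz≈y∙xz; interchange)
  open import Algebra.Properties.Semiring.Sum semiring
    using (sum; sum-cong-≋; sum-replicate-zero; ∑-distrib-+; *-distribˡ-sum; sum-remove)
  open import Algebra.Properties.CommutativeMonoid.Sum *-commutativeMonoid public
    using () renaming (sum to prodFin; sum-cong-≋ to prodFin-cong; sum-replicate-zero to prodFin-replicate-1; sum-remove to prodFin-remove)
  open import Relation.Binary.Reasoning.Setoid setoid
  open Det 0# 1# _+_ _*_ -_ public

  Mat : ℕ → Set c
  Mat n = Fin n → Fin n → Carrier

  minor : ∀ {n} → Mat (suc n) → Fin (suc n) → Mat n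
  minor M j i k = M (suc i) (punchIn j k)

  sumFin≡sum : ∀ n (f : Fin n → Carrier) → sumFin n f ≡ sum f
  sumFin≡sum zero    f = ≡.refl
  sumFin≡sum (suc n) f = ≡.cong (f zero +_) (sumFin≡sum n (f ∘ suc))

  sumFin-cong : ∀ n {f g : Fin n → Carrier} → (∀ i → f i ≈ g i) → sumFin n f ≈ sumFin n g
  sumFin-cong n {f} {g} f≈g rewrite sumFin≡sum n f | sumFin≡sum n g = sum-cong-≋ f≈g

  sumFin-zero : ∀ n {f : Fin n → Carrier} → (∀ i → f i ≈ 0#) → sumFin n f ≈ 0#
  sumFin-zero n {f} f≈0 rewrite sumFin≡sum n f = trans (sum-cong-≋ f≈0) (sum-replicate-zero n)

  sumFin-+ : ∀ n (f g : Fin n → Carrier) → sumFin n (λ i → f i + g i) ≈ sumFin n f + sumFin n g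
  sumFin-+ n f g rewrite sumFin≡sum n (λ i → f i + g i) | sumFin≡sum n f | sumFin≡sum n g = ∑-distrib-+ f g

  sumFin-*ˡ : ∀ n a (f : Fin n → Carrier) → sumFin n (λ i → a * f i) ≈ a * sumFin n f
  sumFin-*ˡ n a f rewrite sumFin≡sum n (λ i → a * f i) | sumFin≡sum n f = sym (*-distribˡ-sum a f)

  sumFin-single : ∀ n (f : Fin n → Carrier) (k : Fin n) → (∀ i → i ≢ k → f i ≈ 0#) → sumFin n f ≈ f k
  sumFin-single (suc n) f k f≈0 = begin
    sumFin (suc n) f                       ≡⟨ sumFin≡sum (suc n) f ⟩
    sum f                                  ≈⟨ sum-remove f ⟩
    f k + sum (f ∘ punchIn k)              ≡⟨ ≡.cong (f k +_) (sumFin≡sum n (f ∘ punchIn k)) ⟨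
    f k + sumFin n (f ∘ punchIn k)         ≈⟨ +-congˡ (sumFin-zero n (λ i → f≈0 (punchIn k i) (Fin.punchInᵢ≢i k i))) ⟩
    f k + 0#                               ≈⟨ +-identityʳ (f k) ⟩
    f k                                    ∎

  sign-cong : ∀ k {x y} → x ≈ y → sign k x ≈ sign k y
  sign-cong zero    x≈y = x≈y
  sign-cong (suc k) x≈y = -‿cong (sign-cong k x≈y)

  sign-0 : ∀ k → sign k 0# ≈ 0#
  sign-0 zero    = refl
  sign-0 (suc k) = trans (-‿cong (sign-0 k)) -0#≈0#

  sign-+ : ∀ k x y → sign k (x + y) ≈ sign k x + sign k y
  sign-+ zero    x y = refl
  sign-+ (suc k) x y = trans (-‿cong (sign-+ k x y)) (sym (-‿+-comm _ _))

  sign-*ˡ : ∀ k a x → sign k (a * x) ≈ a * sign k x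
  sign-*ˡ zero    a x = refl
  sign-*ˡ (suc k) a x = trans (-‿cong (sign-*ˡ k a x)) (-‿distribʳ-* a _)

  sign-sign : ∀ k l x → sign k (sign l x) ≡ sign (k ℕ.+ l) x
  sign-sign zero    l x = ≡.refl
  sign-sign (suc k) l x = ≡.cong -_ (sign-sign k l x)

  sign-sumFin : ∀ k n (f : Fin n → Carrier) → sign k (sumFin n f) ≈ sumFin n (λ i → sign k (f i))
  sign-sumFin k zero    f = sign-0 k
  sign-sumFin k (suc n) f = trans (sign-+ k _ _) (+-congˡ (sign-sumFin k n (f ∘ suc)))

  det-cong : ∀ n {M N : Mat n} → (∀ i j → M i j ≈ N i j) → det n M ≈ det n N
  det-cong zero    M≈N = refl
  det-cong (suc n) M≈N = sumFin-cong (suc n) λ j → sign-cong (toℕ j)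
    (*-cong (M≈N zero j) (det-cong n (λ i k → M≈N (suc i) (punchIn j k))))

  AgreeOffRow : ∀ {n} → Fin n → Mat n → Mat n → Set ℓ
  AgreeOffRow k M N = ∀ i → i ≢ k → ∀ j → M i j ≈ N i j

  det-minor-agree₀ : ∀ {n} {M N : Mat (suc n)} → AgreeOffRow zero M N → ∀ j → det n (minor M j) ≈ det n (minor N j)
  det-minor-agree₀ {n} M≈N j = det-cong n (λ i k → M≈N (suc i) (λ ()) _)

  minor-agree : ∀ {n} {k} {M N : Mat (suc n)} → AgreeOffRow (suc k) M N → ∀ j → AgreeOffRow k (minor M j) (minor N j)
  minor-agree M≈N j i i≢k l = M≈N (suc i) (i≢k ∘ Fin.suc-injective) _

  det-suc-+ : ∀ n (M N Q : Mat (suc n)) →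
    (∀ j → M zero j * det n (minor M j) ≈ N zero j * det n (minor N j) + Q zero j * det n (minor Q j)) →
    det (suc n) M ≈ det (suc n) N + det (suc n) Q
  det-suc-+ n M N Q termwise =
    trans (sumFin-cong (suc n) (λ j → trans (sign-cong (toℕ j) (termwise j)) (sign-+ (toℕ j) _ _)))
      (sumFin-+ (suc n) (λ j → sign (toℕ j) (N zero j * det n (minor N j))) (λ j → sign (toℕ j) (Q zero j * det n (minor Q j))))

  det-suc-*ˡ : ∀ n a (M N : Mat (suc n)) →
    (∀ j → M zero j * det n (minor M j) ≈ a * (N zero j * det n (minor N j))) →
    det (suc n) M ≈ a * det (suc n) N
  det-suc-*ˡ n a M N termwise =
    trans (sumFin-cong (suc n) (λ j → trans (sign-cong (toℕ j) (termwise j)) (sign-*ˡ (toℕ j) a _)))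
      (sumFin-*ˡ (suc n) a (λ j → sign (toℕ j) (N zero j * det n (minor N j))))

  det-row-+ : ∀ n (k : Fin n) (M N Q : Mat n) → AgreeOffRow k M N → AgreeOffRow k M Q →
    (∀ j → M k j ≈ N k j + Q k j) → det n M ≈ det n N + det n Q
  det-row-+ (suc n) zero M N Q M≈N M≈Q Mk = det-suc-+ n M N Q λ j →
    trans (*-congʳ (Mk j))
      (trans (distribʳ _ _ _) (+-cong (*-congˡ (det-minor-agree₀ M≈N j)) (*-congˡ (det-minor-agree₀ M≈Q j))))
  det-row-+ (suc n) (suc k) M N Q M≈N M≈Q Mk = det-suc-+ n M N Q λ j →
    trans (*-congˡ (det-row-+ n k (minor M j) (minor N j) (minor Q j) (minor-agree M≈N j) (minor-agree M≈Q j) (Mk ∘ punchIn j)))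
      (trans (distribˡ _ _ _) (+-cong (*-congʳ (M≈N zero (λ ()) j)) (*-congʳ (M≈Q zero (λ ()) j))))

  det-row-* : ∀ n (k : Fin n) a (M N : Mat n) → AgreeOffRow k M N →
    (∀ j → M k j ≈ a * N k j) → det n M ≈ a * det n N
  det-row-* (suc n) zero a M N M≈N Mk = det-suc-*ˡ n a M N λ j →
    trans (*-cong (Mk j) (det-minor-agree₀ M≈N j)) (*-assoc _ _ _)
  det-row-* (suc n) (suc k) a M N M≈N Mk = det-suc-*ˡ n a M N λ j →
    trans (*-cong (M≈N zero (λ ()) j) (det-row-* n k a (minor M j) (minor N j) (minor-agree M≈N j) (Mk ∘ punchIn j)))
      (x∙yz≈y∙xz _ _ _)

  det-zero-row : ∀ n (k : Fin n) (M : Mat n) → (∀ j → M k j ≈ 0#) → det n M ≈ 0#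
  det-zero-row n k M Mk≈0 =
    trans (det-row-* n k 0# M M (λ _ _ _ → refl) (λ j → trans (Mk≈0 j) (sym (zeroˡ _)))) (zeroˡ _)

  replaceRow : ∀ {n} → Mat n → Fin n → (Fin n → Carrier) → Mat n
  replaceRow M k u i = if does (i Fin.≟ k) then u else M i

  replaceRow-≡ : ∀ {n} (M : Mat n) k u → replaceRow M k u k ≡ u
  replaceRow-≡ M k u = ≡.cong (if_then u else M k) (dec-true (k Fin.≟ k) ≡.refl)

  replaceRow-≢ : ∀ {n} (M : Mat n) k u i → i ≢ k → replaceRow M k u i ≡ M i
  replaceRow-≢ M k u i i≢k = ≡.cong (if_then u else M i) (dec-false (i Fin.≟ k) i≢k)

  replaceRow-agree : ∀ {n} (M N : Mat n) k u v → AgreeOffRow k M N → AgreeOffRow k (replaceRow M k u) (replaceRow N k v)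
  replaceRow-agree M N k u v M≈N i i≢k j rewrite replaceRow-≢ M k u i i≢k | replaceRow-≢ N k v i i≢k = M≈N i i≢k j

  det-replaceRow-+ : ∀ n (M : Mat n) k u v →
    det n (replaceRow M k (λ j → u j + v j)) ≈ det n (replaceRow M k u) + det n (replaceRow M k v)
  det-replaceRow-+ n M k u v = det-row-+ n k _ _ _
    (replaceRow-agree M M k _ u (λ _ _ _ → refl)) (replaceRow-agree M M k _ v (λ _ _ _ → refl))
    (λ j → reflexive (≡.trans (≡.cong-app (replaceRow-≡ M k _) j)
      (≡.cong₂ _+_ (≡.sym (≡.cong-app (replaceRow-≡ M k u) j)) (≡.sym (≡.cong-app (replaceRow-≡ M k v) j)))))

  replaceRow-self : ∀ {n} (M : Mat n) k i → replaceRow M k (M k) i ≡ M i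
  replaceRow-self M k i with i Fin.≟ k
  ... | yes ≡.refl = ≡.refl
  ... | no _       = ≡.refl

  -- The position of column b in the minor that deletes column a (junk when a ≡ b).
  punchOut′ : ∀ {n} → Fin (suc (suc n)) → Fin (suc (suc n)) → Fin (suc n)
  punchOut′         zero    zero    = zero
  punchOut′         zero    (suc j) = j
  punchOut′         (suc i) zero    = zero
  punchOut′ {zero}  (suc i) (suc j) = zero
  punchOut′ {suc n} (suc i) (suc j) = suc (punchOut′ i j)

  punchOut′-punchIn : ∀ {n} (i : Fin (suc (suc n))) k → punchOut′ i (punchIn i k) ≡ k
  punchOut′-punchIn         zero    k       = ≡.refl
  punchOut′-punchIn         (suc i) zero    = ≡.refl
  punchOut′-punchIn {suc n} (suc i) (suc k) = ≡.cong suc (punchOut′-punchIn i k)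

  punchIn-punchOut′ : ∀ {n} {i j : Fin (suc (suc n))} → i ≢ j → punchIn i (punchOut′ i j) ≡ j
  punchIn-punchOut′         {i = zero}  {zero}  i≢j = ⊥-elim (i≢j ≡.refl)
  punchIn-punchOut′         {i = zero}  {suc j} i≢j = ≡.refl
  punchIn-punchOut′         {i = suc i} {zero}  i≢j = ≡.refl
  punchIn-punchOut′ {zero}  {i = suc zero} {suc zero} i≢j = ⊥-elim (i≢j ≡.refl)
  punchIn-punchOut′ {suc n} {i = suc i} {suc j} i≢j = ≡.cong suc (punchIn-punchOut′ (i≢j ∘ ≡.cong suc))

  toℕ-punchOut′-< : ∀ {n} {i j : Fin (suc (suc n))} → i Fin.< j → suc (toℕ (punchOut′ i j)) ≡ toℕ j
  toℕ-punchOut′-<         {i = zero}  {suc j} _ = ≡.refl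
  toℕ-punchOut′-< {zero}  {i = suc zero} {suc zero} (ℕ.s≤s ())
  toℕ-punchOut′-< {suc n} {i = suc i} {suc j} (ℕ.s≤s i<j) = ≡.cong suc (toℕ-punchOut′-< i<j)

  toℕ-punchOut′-> : ∀ {n} {i j : Fin (suc (suc n))} → j Fin.< i → toℕ (punchOut′ i j) ≡ toℕ j
  toℕ-punchOut′->         {i = suc i} {zero}  _ = ≡.refl
  toℕ-punchOut′-> {zero}  {i = suc zero} {suc zero} (ℕ.s≤s ())
  toℕ-punchOut′-> {suc n} {i = suc i} {suc j} (ℕ.s≤s j<i) = ≡.cong suc (toℕ-punchOut′-> j<i)

  punchIn-punchOut′-comm : ∀ {n} {i j : Fin (suc (suc n))} → i ≢ j → ∀ l →
    punchIn i (punchIn (punchOut′ i j) l) ≡ punchIn j (punchIn (punchOut′ j i) l)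
  punchIn-punchOut′-comm         {i = zero}  {zero}  i≢j l = ⊥-elim (i≢j ≡.refl)
  punchIn-punchOut′-comm         {i = zero}  {suc j} i≢j l = ≡.refl
  punchIn-punchOut′-comm         {i = suc i} {zero}  i≢j l = ≡.refl
  punchIn-punchOut′-comm {suc n} {i = suc i} {suc j} i≢j zero    = ≡.refl
  punchIn-punchOut′-comm {suc n} {i = suc i} {suc j} i≢j (suc l) =
    ≡.cong suc (punchIn-punchOut′-comm (i≢j ∘ ≡.cong suc) l)

  offDiagonalSum : ∀ n → (Fin (suc n) → Fin (suc n) → Carrier) → Carrier
  offDiagonalSum n F = sumFin (suc n) (λ a → sumFin n (λ k → F a (punchIn a k)))

  offDiagonalSum-cong : ∀ n {F G : Fin (suc n) → Fin (suc n) → Carrier} →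
    (∀ a b → a ≢ b → F a b ≈ G a b) → offDiagonalSum n F ≈ offDiagonalSum n G
  offDiagonalSum-cong n F≈G =
    sumFin-cong (suc n) (λ a → sumFin-cong n (λ k → F≈G a _ (Fin.punchInᵢ≢i a k ∘ ≡.sym)))

  offDiagonalSum-+ : ∀ n (F G : Fin (suc n) → Fin (suc n) → Carrier) →
    offDiagonalSum n (λ a b → F a b + G a b) ≈ offDiagonalSum n F + offDiagonalSum n G
  offDiagonalSum-+ n F G = trans (sumFin-cong (suc n) (λ a → sumFin-+ n (F a ∘ punchIn a) (G a ∘ punchIn a)))
    (sumFin-+ (suc n) (λ a → sumFin n (F a ∘ punchIn a)) (λ a → sumFin n (G a ∘ punchIn a)))

  offDiagonalSum-suc : ∀ n (F : Fin (suc (suc n)) → Fin (suc (suc n)) → Carrier) →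
    offDiagonalSum (suc n) F ≈ sumFin (suc n) (λ k → F zero (suc k)) +
      (sumFin (suc n) (λ a → F (suc a) zero) + offDiagonalSum n (λ a b → F (suc a) (suc b)))
  offDiagonalSum-suc n F = +-congˡ (sumFin-+ (suc n) (λ a → F (suc a) zero) (λ a → sumFin n (F (suc a) ∘ suc ∘ punchIn a)))

  offDiagonalSum-transpose : ∀ n (F : Fin (suc n) → Fin (suc n) → Carrier) →
    offDiagonalSum n F ≈ offDiagonalSum n (λ a b → F b a)
  offDiagonalSum-transpose zero    F = refl
  offDiagonalSum-transpose (suc n) F = begin
    offDiagonalSum (suc n) F                          ≈⟨ offDiagonalSum-suc n F ⟩
    row + (col + offDiagonalSum n (λ a b → F (suc a) (suc b)))
      ≈⟨ +-congˡ (+-congˡ (offDiagonalSum-transpose n (λ a b → F (suc a) (suc b)))) ⟩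
    row + (col + offDiagonalSum n (λ a b → F (suc b) (suc a)))
      ≈⟨ x∙yz≈y∙xz′ row col _ ⟩
    col + (row + offDiagonalSum n (λ a b → F (suc b) (suc a)))
      ≈⟨ offDiagonalSum-suc n (λ a b → F b a) ⟨
    offDiagonalSum (suc n) (λ a b → F b a)             ∎
    where
    open import Algebra.Properties.CommutativeSemigroup +-commutativeSemigroup using () renaming (x∙yz≈y∙xz to x∙yz≈y∙xz′)
    row = sumFin (suc n) (λ k → F zero (suc k))
    col = sumFin (suc n) (λ a → F (suc a) zero)

  upper : ∀ {n} → Fin n → Fin n → Carrier → Carrier
  upper a b x = if does (a Fin.<? b) then x else 0#

  upper-split : ∀ {n} {a b : Fin n} → a ≢ b → ∀ x → x ≈ upper a b x + upper b a x
  upper-split {a = a} {b} a≢b x with Fin.<-cmp a b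
  ... | tri< a<b _ b≮a rewrite dec-true (a Fin.<? b) a<b | dec-false (b Fin.<? a) b≮a = sym (+-identityʳ x)
  ... | tri≈ _ a≡b _ = ⊥-elim (a≢b a≡b)
  ... | tri> a≮b _ b<a rewrite dec-false (a Fin.<? b) a≮b | dec-true (b Fin.<? a) b<a = sym (+-identityˡ x)

  upper-+ : ∀ {n} (a b : Fin n) x y → upper a b x + upper a b y ≈ upper a b (x + y)
  upper-+ a b x y with does (a Fin.<? b)
  ... | true  = refl
  ... | false = +-identityˡ 0#

  -- Each unordered pair of columns is visited twice, once below and once above the diagonal.
  offDiagonalSum-upper : ∀ n (F : Fin (suc n) → Fin (suc n) → Carrier) →
    offDiagonalSum n F ≈ offDiagonalSum n (λ a b → upper a b (F a b + F b a))
  offDiagonalSum-upper n F = begin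
    offDiagonalSum n F
      ≈⟨ offDiagonalSum-cong n (λ a b a≢b → upper-split a≢b (F a b)) ⟩
    offDiagonalSum n (λ a b → upper a b (F a b) + upper b a (F a b))
      ≈⟨ offDiagonalSum-+ n (λ a b → upper a b (F a b)) (λ a b → upper b a (F a b)) ⟩
    offDiagonalSum n (λ a b → upper a b (F a b)) + offDiagonalSum n (λ a b → upper b a (F a b))
      ≈⟨ +-congˡ (offDiagonalSum-transpose n (λ a b → upper b a (F a b))) ⟩
    offDiagonalSum n (λ a b → upper a b (F a b)) + offDiagonalSum n (λ a b → upper a b (F b a))
      ≈⟨ offDiagonalSum-+ n (λ a b → upper a b (F a b)) (λ a b → upper a b (F b a)) ⟨
    offDiagonalSum n (λ a b → upper a b (F a b) + upper a b (F b a))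
      ≈⟨ offDiagonalSum-cong n (λ a b _ → upper-+ a b (F a b) (F b a)) ⟩
    offDiagonalSum n (λ a b → upper a b (F a b + F b a)) ∎

  -- Expanding along the first two rows, the terms for the column pairs (a , b) and (b , a)
  -- carry opposite signs.
  det-rows₀₁-equal : ∀ n (M : Mat (suc (suc n))) → (∀ j → M zero j ≈ M (suc zero) j) → det (suc (suc n)) M ≈ 0#
  det-rows₀₁-equal n M M₀≈M₁ = begin
    det (suc (suc n)) M
      ≈⟨ sumFin-cong (suc (suc n)) (λ a → trans (sign-cong (toℕ a) (sym (sumFin-*ˡ (suc n) (M zero a) (S a))))
                                                (sign-sumFin (toℕ a) (suc n) (λ k → M zero a * S a k))) ⟩
    sumFin (suc (suc n)) (λ a → sumFin (suc n) (T a))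
      ≈⟨ sumFin-cong (suc (suc n)) (λ a → sumFin-cong (suc n) (λ k → reflexive (≡.cong (T a) (≡.sym (punchOut′-punchIn a k))))) ⟩
    offDiagonalSum (suc n) F
      ≈⟨ offDiagonalSum-upper (suc n) F ⟩
    offDiagonalSum (suc n) (λ a b → upper a b (F a b + F b a))
      ≈⟨ sumFin-zero (suc (suc n)) (λ a → sumFin-zero (suc n) (λ k → upper-cancel a (punchIn a k))) ⟩
    0# ∎
    where
    D : Fin (suc (suc n)) → Fin (suc n) → Carrier
    D a k = det n (minor (minor M a) k)
    S T : Fin (suc (suc n)) → Fin (suc n) → Carrier
    S a k = sign (toℕ k) (M (suc zero) (punchIn a k) * D a k)
    T a k = sign (toℕ a) (M zero a * S a k)
    F : Fin (suc (suc n)) → Fin (suc (suc n)) → Carrier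
    F a b = T a (punchOut′ a b)
    cancel : ∀ {a b} → a Fin.< b → F a b + F b a ≈ 0#
    cancel {a} {b} a<b = begin
      F a b + F b a                                    ≈⟨ +-cong Fab Fba ⟩
      sign (toℕ a ℕ.+ t) X + - sign (toℕ a ℕ.+ t) X    ≈⟨ -‿inverseʳ _ ⟩
      0#                                               ∎
      where
      a≢b : a ≢ b
      a≢b a≡b = ℕ.<-irrefl (≡.cong toℕ a≡b) a<b
      t = toℕ (punchOut′ a b)
      X = M zero a * (M zero b * D a (punchOut′ a b))
      Dba≈Dab : D b (punchOut′ b a) ≈ D a (punchOut′ a b)
      Dba≈Dab = det-cong n (λ i l → reflexive (≡.cong (M (suc (suc i))) (≡.sym (punchIn-punchOut′-comm a≢b l))))
      Fab : F a b ≈ sign (toℕ a ℕ.+ t) X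
      Fab = begin
        sign (toℕ a) (M zero a * sign t (M (suc zero) (punchIn a (punchOut′ a b)) * D a (punchOut′ a b)))
          ≡⟨ ≡.cong (λ c → sign (toℕ a) (M zero a * sign t (M (suc zero) c * D a (punchOut′ a b)))) (punchIn-punchOut′ a≢b) ⟩
        sign (toℕ a) (M zero a * sign t (M (suc zero) b * D a (punchOut′ a b)))
          ≈⟨ sign-cong (toℕ a) (trans (*-congˡ (sign-cong t (*-congʳ (sym (M₀≈M₁ b))))) (sym (sign-*ˡ t _ _))) ⟩
        sign (toℕ a) (sign t X)
          ≡⟨ sign-sign (toℕ a) t X ⟩
        sign (toℕ a ℕ.+ t) X ∎
      Fba : F b a ≈ - sign (toℕ a ℕ.+ t) X
      Fba = begin
        sign (toℕ b) (M zero b * sign (toℕ (punchOut′ b a)) (M (suc zero) (punchIn b (punchOut′ b a)) * D b (punchOut′ b a)))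
          ≡⟨ ≡.cong₂ (λ s c → sign (toℕ b) (M zero b * sign s (M (suc zero) c * D b (punchOut′ b a))))
                     (toℕ-punchOut′-> a<b) (punchIn-punchOut′ (a≢b ∘ ≡.sym)) ⟩
        sign (toℕ b) (M zero b * sign (toℕ a) (M (suc zero) a * D b (punchOut′ b a)))
          ≈⟨ sign-cong (toℕ b) (trans (*-congˡ (sign-cong (toℕ a) (*-cong (sym (M₀≈M₁ a)) Dba≈Dab)))
                                     (trans (sym (sign-*ˡ (toℕ a) _ _)) (sign-cong (toℕ a) (x∙yz≈y∙xz _ _ _)))) ⟩
        sign (toℕ b) (sign (toℕ a) X)
          ≡⟨ ≡.cong (λ s → sign s (sign (toℕ a) X)) (≡.sym (toℕ-punchOut′-< a<b)) ⟩
        - sign t (sign (toℕ a) X)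
          ≡⟨ ≡.cong -_ (≡.trans (sign-sign t (toℕ a) X) (≡.cong (λ s → sign s X) (ℕ.+-comm t (toℕ a)))) ⟩
        - sign (toℕ a ℕ.+ t) X ∎
    upper-cancel : ∀ a b → upper a b (F a b + F b a) ≈ 0#
    upper-cancel a b with a Fin.<? b
    ... | yes a<b rewrite dec-true (a Fin.<? b) a<b = cancel a<b
    ... | no  a≮b rewrite dec-false (a Fin.<? b) a≮b = refl

  replaceRows : ∀ {n} → Mat n → Fin n → (Fin n → Carrier) → Fin n → (Fin n → Carrier) → Mat n
  replaceRows M p u p′ v = replaceRow (replaceRow M p u) p′ v

  det-replaceRows-antisym : ∀ n (M : Mat n) {p p′} → p ≢ p′ →
    (∀ Q → (∀ j → Q p j ≈ Q p′ j) → det n Q ≈ 0#) →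
    ∀ u v → det n (replaceRows M p u p′ v) + det n (replaceRows M p v p′ u) ≈ 0#
  det-replaceRows-antisym n M {p} {p′} p≢p′ alternating u v = begin
    D u v + D v u                         ≈⟨ +-cong (sym (+-identityˡ _)) (sym (+-identityʳ _)) ⟩
    (0# + D u v) + (D v u + 0#)           ≈⟨ +-cong (+-congʳ (sym (D-diag u))) (+-congˡ (sym (D-diag v))) ⟩
    (D u u + D u v) + (D v u + D v v)     ≈⟨ +-cong (det-replaceRow-+ n _ p′ u v) (det-replaceRow-+ n _ p′ u v) ⟨
    D u w + D v w                         ≈⟨ linear-in-p ⟨
    D w w                                 ≈⟨ D-diag w ⟩
    0#                                    ∎
    where
    D : (Fin n → Carrier) → (Fin n → Carrier) → Carrier
    D x y = det n (replaceRows M p x p′ y)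
    w : Fin n → Carrier
    w j = u j + v j
    row-p : ∀ x y → replaceRows M p x p′ y p ≡ x
    row-p x y = ≡.trans (replaceRow-≢ (replaceRow M p x) p′ y p p≢p′) (replaceRow-≡ M p x)
    D-diag : ∀ x → D x x ≈ 0#
    D-diag x = alternating _ (λ j → reflexive (≡.trans (≡.cong-app (row-p x x) j) (≡.sym (≡.cong-app (replaceRow-≡ (replaceRow M p x) p′ x) j))))
    agree : ∀ x y → AgreeOffRow p (replaceRows M p x p′ w) (replaceRows M p y p′ w)
    agree x y i i≢p j with i Fin.≟ p′
    ... | yes _ = refl
    ... | no  _ rewrite replaceRow-≢ M p x i i≢p | replaceRow-≢ M p y i i≢p = refl
    linear-in-p : D w w ≈ D u w + D v w
    linear-in-p = det-row-+ n p _ _ _ (agree w u) (agree w v)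
      (λ j → reflexive (≡.trans (≡.cong-app (row-p w w) j)
        (≡.cong₂ _+_ (≡.sym (≡.cong-app (row-p u w) j)) (≡.sym (≡.cong-app (row-p v w) j)))))

  mutual
    det-rows-equal : ∀ n (M : Mat n) {a b : Fin n} → a Fin.< b → (∀ j → M a j ≈ M b j) → det n M ≈ 0#
    det-rows-equal (suc n)       M {suc a} {suc b}       (ℕ.s≤s a<b) = det-rows-equal-below n M a<b
    det-rows-equal (suc (suc n)) M {zero}  {suc zero}    _           = det-rows₀₁-equal n M
    det-rows-equal (suc (suc n)) M {zero}  {suc (suc b)} _ M₀≈M = begin
      det (suc (suc n)) M                       ≈⟨ det-cong (suc (suc n)) (λ i j → reflexive (≡.cong-app (M≡ i) j)) ⟨
      D (M p) (M p′)
        ≈⟨ +-inverseʳ-unique _ _ (det-replaceRows-antisym (suc (suc n)) M (λ ())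
             (λ Q → det-rows-equal-below (suc n) Q (ℕ.s≤s ℕ.z≤n)) (M p′) (M p)) ⟩
      - D (M p′) (M p)                          ≈⟨ -‿cong (det-rows₀₁-equal n (replaceRows M p (M p′) p′ (M p)) rows₀₁) ⟩
      - 0#                                      ≈⟨ -0#≈0# ⟩
      0#                                        ∎
      where
      p p′ : Fin (suc (suc n))
      p  = suc zero
      p′ = suc (suc b)
      D : (Fin (suc (suc n)) → Carrier) → (Fin (suc (suc n)) → Carrier) → Carrier
      D u v = det (suc (suc n)) (replaceRows M p u p′ v)
      M≡ : ∀ i → replaceRows M p (M p) p′ (M p′) i ≡ M i
      M≡ i = ≡.trans (≡.cong (λ r → replaceRow (replaceRow M p (M p)) p′ r i) (≡.sym (replaceRow-≢ M p (M p) p′ (λ ()))))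
               (≡.trans (replaceRow-self (replaceRow M p (M p)) p′ i) (replaceRow-self M p i))
      rows₀₁ : ∀ j → replaceRows M p (M p′) p′ (M p) zero j ≈ replaceRows M p (M p′) p′ (M p) p j
      rows₀₁ j = begin
        replaceRows M p (M p′) p′ (M p) zero j
          ≡⟨ ≡.cong-app (≡.trans (replaceRow-≢ (replaceRow M p (M p′)) p′ (M p) zero (λ ())) (replaceRow-≢ M p (M p′) zero (λ ()))) j ⟩
        M zero j                                   ≈⟨ M₀≈M j ⟩
        M p′ j
          ≡⟨ ≡.cong-app (≡.trans (replaceRow-≢ (replaceRow M p (M p′)) p′ (M p) p (λ ())) (replaceRow-≡ M p (M p′))) j ⟨
        replaceRows M p (M p′) p′ (M p) p j        ∎

    det-rows-equal-below : ∀ n (M : Mat (suc n)) {a b : Fin n} → a Fin.< b → (∀ j → M (suc a) j ≈ M (suc b) j) →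
      det (suc n) M ≈ 0#
    det-rows-equal-below n M a<b Ma≈Mb = sumFin-zero (suc n) {λ j → sign (toℕ j) (M zero j * det n (minor M j))} λ j →
      trans (sign-cong (toℕ j) (trans (*-congˡ (det-rows-equal n (minor M j) a<b (Ma≈Mb ∘ punchIn j))) (zeroʳ _)))
            (sign-0 (toℕ j))

  prodFin-update : ∀ {n} (f g : Fin n → Carrier) k → (∀ i → i ≢ k → f i ≈ g i) → g k ≈ 1# → prodFin f ≈ f k * prodFin g
  prodFin-update {suc n} f g k f≈g gk≈1 = begin
    prodFin f                                ≈⟨ prodFin-remove {i = k} f ⟩
    f k * prodFin (f ∘ punchIn k)            ≈⟨ *-congˡ (prodFin-cong (λ i → f≈g (punchIn k i) (Fin.punchInᵢ≢i k i))) ⟩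
    f k * prodFin (g ∘ punchIn k)            ≈⟨ *-congˡ (trans (sym (*-identityˡ _)) (*-congʳ (sym gk≈1))) ⟩
    f k * (g k * prodFin (g ∘ punchIn k))    ≈⟨ *-congˡ (prodFin-remove {i = k} g) ⟨
    f k * prodFin g                          ∎

  det-row-scale : ∀ n (r : Fin n → Carrier) (M : Mat n) → det n (λ i j → r i * M i j) ≈ prodFin r * det n M
  det-row-scale zero    r M = sym (*-identityˡ 1#)
  det-row-scale (suc n) r M = det-suc-*ˡ n (prodFin r) (λ i j → r i * M i j) M λ j →
    trans (*-congˡ (det-row-scale n (r ∘ suc) (minor M j))) (interchange _ _ _ _)

  det-col-scale : ∀ n (s : Fin n → Carrier) (M : Mat n) → det n (λ i j → s j * M i j) ≈ prodFin s * det n M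
  det-col-scale zero    s M = sym (*-identityˡ 1#)
  det-col-scale (suc n) s M = det-suc-*ˡ n (prodFin s) (λ i j → s j * M i j) M λ j →
    trans (*-congˡ (det-col-scale n (s ∘ punchIn j) (minor M j)))
          (trans (interchange _ _ _ _) (*-congʳ (sym (prodFin-remove s))))

  det-zero-col : ∀ n (M : Mat n) (k : Fin n) → (∀ i → M i k ≈ 0#) → det n M ≈ 0#
  det-zero-col (suc n) M k Mk≈0 = begin
    det (suc n) M                                   ≈⟨ det-cong (suc n) scaled ⟩
    det (suc n) (λ i j → s j * M i j)               ≈⟨ det-col-scale (suc n) s M ⟩
    prodFin s * det (suc n) M               ≈⟨ *-congʳ (prodFin-remove {i = k} s) ⟩
    (s k * prodFin (s ∘ punchIn k)) * det (suc n) M ≈⟨ *-congʳ (*-congʳ sk≈0) ⟩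
    (0# * prodFin (s ∘ punchIn k)) * det (suc n) M  ≈⟨ trans (*-congʳ (zeroˡ _)) (zeroˡ _) ⟩
    0#                                              ∎
    where
    s : Fin (suc n) → Carrier
    s j = if does (j Fin.≟ k) then 0# else 1#
    sk≈0 : s k ≈ 0#
    sk≈0 rewrite dec-true (k Fin.≟ k) ≡.refl = refl
    scaled : ∀ i j → M i j ≈ s j * M i j
    scaled i j with j Fin.≟ k
    ... | yes ≡.refl = trans (Mk≈0 i) (sym (zeroˡ _))
    ... | no  _      = sym (*-identityˡ _)

  det-replaceRow-*ˡ : ∀ n (M : Mat n) k a u → det n (replaceRow M k (λ j → a * u j)) ≈ a * det n (replaceRow M k u)
  det-replaceRow-*ˡ n M k a u = det-row-* n k a _ _ (replaceRow-agree M M k _ u (λ _ _ _ → refl))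
    (λ j → reflexive (≡.trans (≡.cong-app (replaceRow-≡ M k _) j) (≡.cong (a *_) (≡.sym (≡.cong-app (replaceRow-≡ M k u) j)))))

  det-replaceRow-sum : ∀ n (M : Mat n) k B (coeff : Fin B → Carrier) (U : Fin B → Fin n → Carrier) →
    det n (replaceRow M k (λ j → sumFin B (λ b → coeff b * U b j))) ≈ sumFin B (λ b → coeff b * det n (replaceRow M k (U b)))
  det-replaceRow-sum n M k zero    coeff U =
    det-zero-row n k _ (λ j → reflexive (≡.cong-app (replaceRow-≡ M k (λ _ → 0#)) j))
  det-replaceRow-sum n M k (suc B) coeff U = begin
    det n (replaceRow M k (λ j → coeff zero * U zero j + rest j))
      ≈⟨ det-replaceRow-+ n M k _ rest ⟩
    det n (replaceRow M k (λ j → coeff zero * U zero j)) + det n (replaceRow M k rest)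
      ≈⟨ +-cong (det-replaceRow-*ˡ n M k (coeff zero) (U zero)) (det-replaceRow-sum n M k B (coeff ∘ suc) (U ∘ suc)) ⟩
    coeff zero * det n (replaceRow M k (U zero)) + sumFin B (λ b → coeff (suc b) * det n (replaceRow M k (U (suc b)))) ∎
    where
    rest : Fin n → Carrier
    rest j = sumFin B (λ b → coeff (suc b) * U (suc b) j)

  module _ {n} (L N : Mat n) (L-lower : ∀ i b → i Fin.< b → L i b ≈ 0#) where

    private
      LN : Mat n
      LN i j = sumFin n (λ b → L i b * N b j)

      partial : ℕ → Mat n
      partial t i = if does (toℕ i ℕ.<? t) then N i else LN i

      diagEntry : ℕ → Fin n → Carrier
      diagEntry t i = if does (toℕ i ℕ.<? t) then 1# else L i i

      diagFrom : ℕ → Carrier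
      diagFrom t = prodFin (diagEntry t)

      -- Multilinearity in row t turns Σ_b L_tb N_b into L_tt N_t: for b < t the row N_b
      -- already occurs above, and for b > t the coefficient vanishes.
      det-partial : ∀ d t → t ℕ.+ d ≡ n → det n (partial t) ≈ diagFrom t * det n N
      det-partial zero t t≡n = begin
        det n (partial t)   ≈⟨ det-cong n (λ i j → reflexive (≡.cong-app (≡.cong (if_then N i else LN i) (below i)) j)) ⟩
        det n N             ≈⟨ *-identityˡ _ ⟨
        1# * det n N        ≈⟨ *-congʳ (trans (prodFin-cong (λ i → reflexive (≡.cong (if_then 1# else L i i) (below i))))
                                              (prodFin-replicate-1 n)) ⟨
        diagFrom t * det n N ∎
        where
        below : ∀ i → does (toℕ i ℕ.<? t) ≡ true
        below i = dec-true (toℕ i ℕ.<? t) (≡.subst (toℕ i ℕ.<_) (≡.trans (≡.sym t≡n) (ℕ.+-identityʳ t)) (Fin.toℕ<n i))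
      det-partial (suc d) t t+d+1≡n = begin
        det n (partial t)
          ≈⟨ det-cong n (λ i j → reflexive (≡.cong-app (≡.sym (≡.trans (≡.cong (λ r → replaceRow (partial t) k r i) (≡.sym k-row))
                                                                          (replaceRow-self (partial t) k i))) j)) ⟩
        det n (replaceRow (partial t) k (λ j → sumFin n (λ b → L k b * N b j)))
          ≈⟨ det-replaceRow-sum n (partial t) k n (L k) N ⟩
        sumFin n (λ b → L k b * det n (replaceRow (partial t) k (N b)))
          ≈⟨ sumFin-single n _ k off-diagonal ⟩
        L k k * det n (replaceRow (partial t) k (N k))
          ≈⟨ *-congˡ (det-cong n (λ i j → reflexive (≡.cong-app (next-row i) j))) ⟩
        L k k * det n (partial (suc t))
          ≈⟨ *-congˡ (det-partial d (suc t) (≡.trans (≡.sym (ℕ.+-suc t d)) t+d+1≡n)) ⟩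
        L k k * (diagFrom (suc t) * det n N)
          ≈⟨ *-assoc _ _ _ ⟨
        (L k k * diagFrom (suc t)) * det n N
          ≈⟨ *-congʳ diag-step ⟨
        diagFrom t * det n N ∎
        where
        t<n : t ℕ.< n
        t<n = ≡.subst (t ℕ.<_) t+d+1≡n (ℕ.m<m+n t ℕ.z<s)
        k : Fin n
        k = Fin.fromℕ< t<n
        toℕ-k : toℕ k ≡ t
        toℕ-k = Fin.toℕ-fromℕ< t<n
        k-now : does (toℕ k ℕ.<? t) ≡ false
        k-now = dec-false (toℕ k ℕ.<? t) (ℕ.<-irrefl toℕ-k)
        k-row : partial t k ≡ LN k
        k-row = ≡.cong (if_then N k else LN k) k-now
        k-next : does (toℕ k ℕ.<? suc t) ≡ true
        k-next = dec-true (toℕ k ℕ.<? suc t) (ℕ.≤-reflexive (≡.cong suc toℕ-k))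
        others : ∀ i → i ≢ k → does (toℕ i ℕ.<? t) ≡ does (toℕ i ℕ.<? suc t)
        others i i≢k with ℕ.<-cmp (toℕ i) t
        ... | tri< i<t _ _ = ≡.trans (dec-true (toℕ i ℕ.<? t) i<t) (≡.sym (dec-true (toℕ i ℕ.<? suc t) (ℕ.m<n⇒m<1+n i<t)))
        ... | tri≈ _ i≡t _ = ⊥-elim (i≢k (Fin.toℕ-injective (≡.trans i≡t (≡.sym toℕ-k))))
        ... | tri> _ _ t<i = ≡.trans (dec-false (toℕ i ℕ.<? t) (ℕ.<⇒≯ t<i))
                               (≡.sym (dec-false (toℕ i ℕ.<? suc t) (ℕ.<⇒≱ t<i ∘ ℕ.≤-pred)))
        next-row : ∀ i → replaceRow (partial t) k (N k) i ≡ partial (suc t) i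
        next-row i with i Fin.≟ k
        ... | yes ≡.refl = ≡.sym (≡.cong (if_then N i else LN i) k-next)
        ... | no  i≢k    = ≡.cong (if_then N i else LN i) (others i i≢k)
        off-diagonal : ∀ b → b ≢ k → L k b * det n (replaceRow (partial t) k (N b)) ≈ 0#
        off-diagonal b b≢k with Fin.<-cmp b k
        ... | tri< b<k _ _ = trans (*-congˡ (det-rows-equal n _ b<k (λ j → reflexive (≡.cong-app rows-b-k j)))) (zeroʳ _)
          where
          rows-b-k : replaceRow (partial t) k (N b) b ≡ replaceRow (partial t) k (N b) k
          rows-b-k = ≡.trans (replaceRow-≢ (partial t) k (N b) b b≢k)
            (≡.trans (≡.cong (if_then N b else LN b) (dec-true (toℕ b ℕ.<? t) (≡.subst (toℕ b ℕ.<_) toℕ-k b<k)))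
                     (≡.sym (replaceRow-≡ (partial t) k (N b))))
        ... | tri≈ _ b≡k _ = ⊥-elim (b≢k b≡k)
        ... | tri> _ _ k<b = trans (*-congʳ (L-lower k b k<b)) (zeroˡ _)
        diag-step : diagFrom t ≈ L k k * diagFrom (suc t)
        diag-step = trans (prodFin-update (diagEntry t) (diagEntry (suc t)) k
                            (λ i i≢k → reflexive (≡.cong (if_then 1# else L i i) (others i i≢k)))
                            (reflexive (≡.cong (if_then 1# else L k k) k-next)))
                          (*-congʳ (reflexive (≡.cong (if_then 1# else L k k) k-now)))

    det-lowerTriangular-* : det n (λ i j → sumFin n (λ b → L i b * N b j)) ≈ prodFin (λ i → L i i) * det n N
    det-lowerTriangular-* = det-partial n 0 ≡.refl

module Sums {c ℓ : Level} (R : CommutativeRing c ℓ) where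
  open CommutativeRing R hiding (zero)
  open import Algebra.Properties.CommutativeSemigroup +-commutativeSemigroup using (interchange)
  open import Relation.Binary.Reasoning.Setoid setoid
  open Det 0# 1# _+_ _*_ -_ using (sumFin)

  sumTo-cong : ∀ n {f g : ℕ → Carrier} → (∀ i → i ℕ.< n → f i ≈ g i) → sumTo R n f ≈ sumTo R n g
  sumTo-cong zero    f≈g = refl
  sumTo-cong (suc n) f≈g = +-cong (sumTo-cong n (λ i i<n → f≈g i (ℕ.m<n⇒m<1+n i<n))) (f≈g n (ℕ.n<1+n n))

  sumTo-zero : ∀ n {f : ℕ → Carrier} → (∀ i → i ℕ.< n → f i ≈ 0#) → sumTo R n f ≈ 0#
  sumTo-zero zero    f≈0 = refl
  sumTo-zero (suc n) f≈0 =
    trans (+-cong (sumTo-zero n (λ i i<n → f≈0 i (ℕ.m<n⇒m<1+n i<n))) (f≈0 n (ℕ.n<1+n n))) (+-identityˡ 0#)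

  sumTo-+ : ∀ n (f g : ℕ → Carrier) → sumTo R n (λ i → f i + g i) ≈ sumTo R n f + sumTo R n g
  sumTo-+ zero    f g = sym (+-identityˡ 0#)
  sumTo-+ (suc n) f g = trans (+-congʳ (sumTo-+ n f g)) (interchange _ _ _ _)

  sumTo-*ˡ : ∀ n a (f : ℕ → Carrier) → sumTo R n (λ i → a * f i) ≈ a * sumTo R n f
  sumTo-*ˡ zero    a f = sym (zeroʳ a)
  sumTo-*ˡ (suc n) a f = trans (+-congʳ (sumTo-*ˡ n a f)) (sym (distribˡ a _ _))

  sumTo-*ʳ : ∀ n a (f : ℕ → Carrier) → sumTo R n (λ i → f i * a) ≈ sumTo R n f * a
  sumTo-*ʳ n a f = trans (sumTo-cong n (λ i _ → *-comm (f i) a)) (trans (sumTo-*ˡ n a f) (*-comm a _))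

  sumTo-suc : ∀ n (f : ℕ → Carrier) → sumTo R (suc n) f ≈ f 0 + sumTo R n (f ∘ suc)
  sumTo-suc zero    f = trans (+-identityˡ _) (sym (+-identityʳ _))
  sumTo-suc (suc n) f = trans (+-congʳ (sumTo-suc n f)) (+-assoc _ _ _)

  sumFin-toℕ : ∀ n (f : ℕ → Carrier) → sumFin n (f ∘ toℕ) ≈ sumTo R n f
  sumFin-toℕ zero    f = refl
  sumFin-toℕ (suc n) f = trans (+-congˡ (sumFin-toℕ n (f ∘ suc))) (sym (sumTo-suc n f))

  sumTo-single : ∀ n (f : ℕ → Carrier) k → k ℕ.< n → (∀ i → i ℕ.< n → i ≢ k → f i ≈ 0#) → sumTo R n f ≈ f k
  sumTo-single (suc n) f k k<1+n f≈0 with ℕ.<-cmp k n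
  ... | tri< k<n _ _ =
    trans (+-cong (sumTo-single n f k k<n (λ i i<n → f≈0 i (ℕ.m<n⇒m<1+n i<n))) (f≈0 n (ℕ.n<1+n n) (ℕ.<⇒≢ k<n ∘ ≡.sym)))
          (+-identityʳ _)
  ... | tri≈ _ ≡.refl _ =
    trans (+-congʳ (sumTo-zero n (λ i i<n → f≈0 i (ℕ.m<n⇒m<1+n i<n) (ℕ.<⇒≢ i<n)))) (+-identityˡ _)
  ... | tri> _ _ n<k = ⊥-elim (ℕ.<⇒≱ n<k (ℕ.≤-pred k<1+n))

  sumTo-reverse : ∀ n (f : ℕ → Carrier) → sumTo R n f ≈ sumTo R n (λ i → f (n ∸ suc i))
  sumTo-reverse zero    f = refl
  sumTo-reverse (suc n) f = begin
    sumTo R n f + f n                               ≈⟨ +-congʳ (sumTo-reverse n f) ⟩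
    sumTo R n (λ i → f (n ∸ suc i)) + f n           ≈⟨ +-comm _ _ ⟩
    f n + sumTo R n (λ i → f (n ∸ suc i))           ≈⟨ sumTo-suc n (λ i → f (n ∸ i)) ⟨
    sumTo R (suc n) (λ i → f (n ∸ i))               ∎

  sumTo-extend : ∀ n m (f : ℕ → Carrier) → n ℕ.≤ m → (∀ i → n ℕ.≤ i → f i ≈ 0#) → sumTo R m f ≈ sumTo R n f
  sumTo-extend n m f n≤m f≈0 with ℕ.m≤n⇒∃[o]m+o≡n n≤m
  ... | d , ≡.refl = go d
    where
    go : ∀ d → sumTo R (n ℕ.+ d) f ≈ sumTo R n f
    go zero    = reflexive (≡.cong (λ k → sumTo R k f) (ℕ.+-identityʳ n))
    go (suc d) = begin
      sumTo R (n ℕ.+ suc d) f             ≡⟨ ≡.cong (λ k → sumTo R k f) (ℕ.+-suc n d) ⟩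
      sumTo R (n ℕ.+ d) f + f (n ℕ.+ d)   ≈⟨ +-cong (go d) (f≈0 _ (ℕ.m≤m+n n d)) ⟩
      sumTo R n f + 0#                    ≈⟨ +-identityʳ _ ⟩
      sumTo R n f                         ∎

  sumTo-triangle : ∀ n (F : ℕ → ℕ → Carrier) →
    sumTo R n (λ k → sumTo R (suc k) (λ i → F i k)) ≈ sumTo R n (λ i → sumTo R (n ∸ i) (λ j → F i (i ℕ.+ j)))
  sumTo-triangle zero    F = refl
  sumTo-triangle (suc n) F = begin
    sumTo R n (λ k → sumTo R (suc k) (λ i → F i k)) + sumTo R (suc n) (λ i → F i n)
      ≈⟨ +-congʳ (sumTo-triangle n F) ⟩
    sumTo R n (λ i → sumTo R (n ∸ i) (λ j → F i (i ℕ.+ j))) + sumTo R (suc n) (λ i → F i n)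
      ≈⟨ +-congʳ (sumTo-extend n (suc n) _ (ℕ.n≤1+n n) (λ i n≤i → reflexive (≡.cong (λ m → sumTo R m (λ j → F i (i ℕ.+ j))) (ℕ.m≤n⇒m∸n≡0 n≤i)))) ⟨
    sumTo R (suc n) (λ i → sumTo R (n ∸ i) (λ j → F i (i ℕ.+ j))) + sumTo R (suc n) (λ i → F i n)
      ≈⟨ sumTo-+ (suc n) _ _ ⟨
    sumTo R (suc n) (λ i → sumTo R (n ∸ i) (λ j → F i (i ℕ.+ j)) + F i n)
      ≈⟨ sumTo-cong (suc n) (λ i i≤n → +-congˡ (reflexive (≡.cong (F i) (≡.sym (ℕ.m+[n∸m]≡n (ℕ.≤-pred i≤n)))))) ⟩
    sumTo R (suc n) (λ i → sumTo R (n ∸ i) (λ j → F i (i ℕ.+ j)) + F i (i ℕ.+ (n ∸ i)))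
      ≈⟨ sumTo-cong (suc n) (λ i i≤n → reflexive (≡.cong (λ m → sumTo R m (λ j → F i (i ℕ.+ j))) (≡.sym (ℕ.+-∸-assoc 1 (ℕ.≤-pred i≤n))))) ⟩
    sumTo R (suc n) (λ i → sumTo R (suc n ∸ i) (λ j → F i (i ℕ.+ j))) ∎

module Polynomials {c ℓ : Level} (R : CommutativeRing c ℓ) where
  open CommutativeRing R hiding (zero)
  open Sums R
  open import Relation.Binary.Reasoning.Setoid setoid

  infix 4 _≈P_
  _≈P_ : Poly R → Poly R → Set ℓ
  f ≈P g = ∀ m → f m ≈ g m

  _⊕_ _⊛_ : Poly R → Poly R → Poly R
  _⊕_ = _+P_ R
  _⊛_ = _*P_ R

  *P-cong : ∀ {f f′ g g′} → f ≈P f′ → g ≈P g′ → (f ⊛ g) ≈P (f′ ⊛ g′)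
  *P-cong f≈f′ g≈g′ m = sumTo-cong (suc m) (λ i _ → *-cong (f≈f′ i) (g≈g′ (m ∸ i)))

  *P-comm : ∀ f g → (f ⊛ g) ≈P (g ⊛ f)
  *P-comm f g m = begin
    sumTo R (suc m) (λ i → f i * g (m ∸ i))               ≈⟨ sumTo-reverse (suc m) (λ i → f i * g (m ∸ i)) ⟩
    sumTo R (suc m) (λ i → f (m ∸ i) * g (m ∸ (m ∸ i)))   ≈⟨ sumTo-cong (suc m) (λ i i≤m →
                                                             trans (*-comm _ _) (*-congʳ (reflexive (≡.cong g (ℕ.m∸[m∸n]≡n (ℕ.≤-pred i≤m)))))) ⟩
    sumTo R (suc m) (λ i → g i * f (m ∸ i))               ∎

  *P-assoc : ∀ f g h → ((f ⊛ g) ⊛ h) ≈P (f ⊛ (g ⊛ h))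
  *P-assoc f g h m = begin
    sumTo R (suc m) (λ k → sumTo R (suc k) (λ i → f i * g (k ∸ i)) * h (m ∸ k))
      ≈⟨ sumTo-cong (suc m) (λ k _ → sym (sumTo-*ʳ (suc k) (h (m ∸ k)) (λ i → f i * g (k ∸ i)))) ⟩
    sumTo R (suc m) (λ k → sumTo R (suc k) (λ i → (f i * g (k ∸ i)) * h (m ∸ k)))
      ≈⟨ sumTo-triangle (suc m) (λ i k → (f i * g (k ∸ i)) * h (m ∸ k)) ⟩
    sumTo R (suc m) (λ i → sumTo R (suc m ∸ i) (λ j → (f i * g ((i ℕ.+ j) ∸ i)) * h (m ∸ (i ℕ.+ j))))
      ≈⟨ sumTo-cong (suc m) inner ⟩
    sumTo R (suc m) (λ i → f i * sumTo R (suc (m ∸ i)) (λ j → g j * h ((m ∸ i) ∸ j))) ∎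
    where
    inner : ∀ i → i ℕ.< suc m →
      sumTo R (suc m ∸ i) (λ j → (f i * g ((i ℕ.+ j) ∸ i)) * h (m ∸ (i ℕ.+ j))) ≈
      f i * sumTo R (suc (m ∸ i)) (λ j → g j * h ((m ∸ i) ∸ j))
    inner i i≤m = begin
      sumTo R (suc m ∸ i) (λ j → (f i * g ((i ℕ.+ j) ∸ i)) * h (m ∸ (i ℕ.+ j)))
        ≡⟨ ≡.cong (λ n → sumTo R n (λ j → (f i * g ((i ℕ.+ j) ∸ i)) * h (m ∸ (i ℕ.+ j)))) (ℕ.+-∸-assoc 1 (ℕ.≤-pred i≤m)) ⟩
      sumTo R (suc (m ∸ i)) (λ j → (f i * g ((i ℕ.+ j) ∸ i)) * h (m ∸ (i ℕ.+ j)))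
        ≈⟨ sumTo-cong (suc (m ∸ i)) (λ j _ → trans (*-assoc _ _ _) (*-congˡ (*-cong
             (reflexive (≡.cong g (ℕ.m+n∸m≡n i j))) (reflexive (≡.cong h (≡.sym (ℕ.∸-+-assoc m i j))))))) ⟩
      sumTo R (suc (m ∸ i)) (λ j → f i * (g j * h ((m ∸ i) ∸ j)))
        ≈⟨ sumTo-*ˡ (suc (m ∸ i)) (f i) (λ j → g j * h ((m ∸ i) ∸ j)) ⟩
      f i * sumTo R (suc (m ∸ i)) (λ j → g j * h ((m ∸ i) ∸ j)) ∎

  *P-identityˡ : ∀ f → (1P R ⊛ f) ≈P f
  *P-identityˡ f m = trans (sumTo-single (suc m) _ 0 (ℕ.s≤s ℕ.z≤n) higher) (*-identityˡ (f m))
    where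
    higher : ∀ i → i ℕ.< suc m → i ≢ 0 → 1P R i * f (m ∸ i) ≈ 0#
    higher zero    _ i≢0 = ⊥-elim (i≢0 ≡.refl)
    higher (suc i) _ _   = zeroˡ _

  *P-distribˡ : ∀ f g h → (f ⊛ (g ⊕ h)) ≈P ((f ⊛ g) ⊕ (f ⊛ h))
  *P-distribˡ f g h m = trans (sumTo-cong (suc m) (λ i _ → distribˡ (f i) _ _)) (sumTo-+ (suc m) _ _)

  polyRing : CommutativeRing c ℓ
  polyRing = record
    { Carrier = Poly R
    ; _≈_ = _≈P_
    ; _+_ = _⊕_
    ; _*_ = _⊛_
    ; -_ = -P_ R
    ; 0# = 0P R
    ; 1# = 1P R
    ; isCommutativeRing = record
      { isRing = record
        { +-isAbelianGroup = record
          { isGroup = record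
            { isMonoid = record
              { isSemigroup = record
                { isMagma = record
                  { isEquivalence = record { refl = λ _ → refl ; sym = λ f≈g m → sym (f≈g m) ; trans = λ f≈g g≈h m → trans (f≈g m) (g≈h m) }
                  ; ∙-cong = λ f≈f′ g≈g′ m → +-cong (f≈f′ m) (g≈g′ m) }
                ; assoc = λ f g h m → +-assoc (f m) (g m) (h m) }
              ; identity = (λ f m → +-identityˡ (f m)) , (λ f m → +-identityʳ (f m)) }
            ; inverse = (λ f m → -‿inverseˡ (f m)) , (λ f m → -‿inverseʳ (f m))
            ; ⁻¹-cong = λ f≈g m → -‿cong (f≈g m) }
          ; comm = λ f g m → +-comm (f m) (g m) }
        ; *-cong = *P-cong
        ; *-assoc = *P-assoc
        ; *-identity = *P-identityˡ , (λ f m → trans (*P-comm f (1P R) m) (*P-identityˡ f m))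
        ; distrib = *P-distribˡ , (λ f g h m → trans (*P-comm (g ⊕ h) f m)
                                   (trans (*P-distribˡ f g h m) (+-cong (*P-comm f g m) (*P-comm f h m)))) }
      ; *-comm = *P-comm }
    }

  module PR = CommutativeRing polyRing
  module DetR = Determinant R
  module DetP = Determinant polyRing
  module SumsP = Sums polyRing

  sumFinP-eval : ∀ n (F : Fin n → Poly R) m → DetP.sumFin n F m ≡ DetR.sumFin n (λ j → F j m)
  sumFinP-eval zero    F m = ≡.refl
  sumFinP-eval (suc n) F m = ≡.cong (F zero m +_) (sumFinP-eval n (F ∘ suc) m)

  sumToP-eval : ∀ n (F : ℕ → Poly R) m → sumTo polyRing n F m ≡ sumTo R n (λ j → F j m)
  sumToP-eval zero    F m = ≡.refl
  sumToP-eval (suc n) F m = ≡.cong (_+ F n m) (sumToP-eval n F m)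

  signP-eval : ∀ k f m → DetP.sign k f m ≡ DetR.sign k (f m)
  signP-eval zero    f m = ≡.refl
  signP-eval (suc k) f m = ≡.cong -_ (signP-eval k f m)

  detP-eval : ∀ n (M : DetP.Mat (suc n)) m →
    DetP.det (suc n) M m ≈ DetR.sumFin (suc n) (λ j → DetR.sign (toℕ j) ((M zero j ⊛ DetP.det n (DetP.minor M j)) m))
  detP-eval n M m = trans (reflexive (sumFinP-eval (suc n) (λ j → DetP.sign (toℕ j) (term j)) m))
                          (DetR.sumFin-cong (suc n) (λ j → reflexive (signP-eval (toℕ j) (term j) m)))
    where
    term : Fin (suc n) → Poly R
    term j = M zero j ⊛ DetP.det n (DetP.minor M j)

  mono-≡ : ∀ a d → mono R a d d ≈ a
  mono-≡ a d = reflexive (≡.cong (if_then a else 0#) (dec-true (d ℕ.≟ d) ≡.refl))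

  mono-≢ : ∀ a {d m} → d ≢ m → mono R a d m ≈ 0#
  mono-≢ a {d} {m} d≢m = reflexive (≡.cong (if_then a else 0#) (dec-false (d ℕ.≟ m) d≢m))

  mono-zero : ∀ {a} d → a ≈ 0# → mono R a d ≈P 0P R
  mono-zero {a} d a≈0 m with d ℕ.≟ m
  ... | yes ≡.refl = trans (mono-≡ a d) a≈0
  ... | no  d≢m    = mono-≢ a d≢m

  mono-cong : ∀ {a b} d → a ≈ b → mono R a d ≈P mono R b d
  mono-cong {a} {b} d a≈b m with d ℕ.≟ m
  ... | yes ≡.refl = trans (mono-≡ a d) (trans a≈b (sym (mono-≡ b d)))
  ... | no  d≢m    = trans (mono-≢ a d≢m) (sym (mono-≢ b d≢m))

  sumTo-mono : ∀ n (f : ℕ → Carrier) d → sumTo polyRing n (λ i → mono R (f i) d) ≈P mono R (sumTo R n f) d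
  sumTo-mono n f d m with d ℕ.≟ m
  ... | yes ≡.refl = trans (reflexive (sumToP-eval n _ d)) (trans (sumTo-cong n (λ i _ → mono-≡ (f i) d)) (sym (mono-≡ _ d)))
  ... | no  d≢m    = trans (reflexive (sumToP-eval n _ m)) (trans (sumTo-zero n (λ i _ → mono-≢ (f i) d≢m)) (sym (mono-≢ _ d≢m)))

  Deg≤ : Poly R → ℕ → Set ℓ
  Deg≤ f d = ∀ m → d ℕ.< m → f m ≈ 0#

  mono-deg≤ : ∀ a d → Deg≤ (mono R a d) d
  mono-deg≤ a d m d<m = mono-≢ a (ℕ.<⇒≢ d<m)

  *P-deg≤ : ∀ f g {a b} → Deg≤ f a → Deg≤ g b → Deg≤ (f ⊛ g) (a ℕ.+ b)
  *P-deg≤ f g {a} {b} f≤a g≤b m a+b<m = sumTo-zero (suc m) term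
    where
    term : ∀ i → i ℕ.< suc m → f i * g (m ∸ i) ≈ 0#
    term i _ with ℕ.≤-<-connex i a
    ... | inj₂ a<i = trans (*-congʳ (f≤a i a<i)) (zeroˡ _)
    ... | inj₁ i≤a = trans (*-congˡ (g≤b (m ∸ i) (ℕ.+-cancelˡ-< i b (m ∸ i) (≡.subst (i ℕ.+ b ℕ.<_) (≡.sym i+[m∸i]≡m)
                                          (ℕ.≤-<-trans (ℕ.+-monoˡ-≤ b i≤a) a+b<m))))) (zeroʳ _)
      where
      i+[m∸i]≡m : i ℕ.+ (m ∸ i) ≡ m
      i+[m∸i]≡m = ℕ.m+[n∸m]≡n (ℕ.≤-trans i≤a (ℕ.≤-trans (ℕ.m≤m+n a b) (ℕ.<⇒≤ a+b<m)))

  *P-top : ∀ f g {a b} → Deg≤ f a → Deg≤ g b → (f ⊛ g) (a ℕ.+ b) ≈ f a * g b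
  *P-top f g {a} {b} f≤a g≤b =
    trans (sumTo-single (suc (a ℕ.+ b)) _ a (ℕ.s≤s (ℕ.m≤m+n a b)) term) (*-congˡ (reflexive (≡.cong g (ℕ.m+n∸m≡n a b))))
    where
    term : ∀ i → i ℕ.< suc (a ℕ.+ b) → i ≢ a → f i * g ((a ℕ.+ b) ∸ i) ≈ 0#
    term i _ i≢a with ℕ.<-cmp i a
    ... | tri< i<a _ _ = trans (*-congˡ (g≤b _ (ℕ.+-cancelˡ-< i b _ (≡.subst (i ℕ.+ b ℕ.<_)
                            (≡.sym (ℕ.m+[n∸m]≡n (ℕ.≤-trans (ℕ.<⇒≤ i<a) (ℕ.m≤m+n a b)))) (ℕ.+-monoˡ-< b i<a))))) (zeroʳ _)
    ... | tri≈ _ i≡a _ = ⊥-elim (i≢a i≡a)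
    ... | tri> _ _ a<i = trans (*-congʳ (f≤a i a<i)) (zeroˡ _)

  mono-* : ∀ a d b e → (mono R a d ⊛ mono R b e) ≈P mono R (a * b) (d ℕ.+ e)
  mono-* a d b e m with ℕ.<-cmp m (d ℕ.+ e)
  ... | tri< m<d+e _ _ = trans (sumTo-zero (suc m) term) (sym (mono-≢ (a * b) (ℕ.<⇒≢ m<d+e ∘ ≡.sym)))
    where
    term : ∀ i → i ℕ.< suc m → mono R a d i * mono R b e (m ∸ i) ≈ 0#
    term i i≤m with d ℕ.≟ i
    ... | no  d≢i    = trans (*-congʳ (mono-≢ a d≢i)) (zeroˡ _)
    ... | yes ≡.refl = trans (*-congˡ (mono-≢ b e≢m∸d)) (zeroʳ _)
      where
      e≢m∸d : e ≢ m ∸ d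
      e≢m∸d e≡m∸d = ℕ.<⇒≢ m<d+e (≡.trans (≡.sym (ℕ.m+[n∸m]≡n (ℕ.≤-pred i≤m))) (≡.cong (d ℕ.+_) (≡.sym e≡m∸d)))
  ... | tri≈ _ ≡.refl _ = trans (*P-top (mono R a d) (mono R b e) (mono-deg≤ a d) (mono-deg≤ b e))
                                 (trans (*-cong (mono-≡ a d) (mono-≡ b e)) (sym (mono-≡ (a * b) (d ℕ.+ e))))
  ... | tri> _ _ d+e<m = trans (*P-deg≤ (mono R a d) (mono R b e) (mono-deg≤ a d) (mono-deg≤ b e) m d+e<m)
                               (sym (mono-≢ (a * b) (ℕ.<⇒≢ d+e<m)))

  const-*P : ∀ a f m → (mono R a 0 ⊛ f) m ≈ a * f m
  const-*P a f m = sumTo-single (suc m) _ 0 (ℕ.s≤s ℕ.z≤n) higher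
    where
    higher : ∀ i → i ℕ.< suc m → i ≢ 0 → mono R a 0 i * f (m ∸ i) ≈ 0#
    higher zero    _ i≢0 = ⊥-elim (i≢0 ≡.refl)
    higher (suc i) _ _   = zeroˡ _

  det-deg≤ : ∀ n (M : DetP.Mat n) (d : Fin n → ℕ) → (∀ i j → Deg≤ (M i j) (d j)) → Deg≤ (DetP.det n M) (sumℕ d)
  det-deg≤ zero    M d M≤d (suc m) _ = refl
  det-deg≤ (suc n) M d M≤d m Σd<m = trans (detP-eval n M m) (DetR.sumFin-zero (suc n) λ j →
    trans (DetR.sign-cong (toℕ j)
            (*P-deg≤ (M zero j) _ (M≤d zero j) (det-deg≤ n (DetP.minor M j) (d ∘ punchIn j) (λ i k → M≤d (suc i) (punchIn j k)))
                     m (≡.subst (ℕ._< m) (sumℕ-remove {i = j} d) Σd<m)))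
          (DetR.sign-0 (toℕ j)))

  det-top : ∀ n (M : DetP.Mat n) (d : Fin n → ℕ) → (∀ i j → Deg≤ (M i j) (d j)) →
    DetP.det n M (sumℕ d) ≈ DetR.det n (λ i j → M i j (d j))
  det-top zero    M d M≤d = refl
  det-top (suc n) M d M≤d = trans (detP-eval n M (sumℕ d)) (DetR.sumFin-cong (suc n) λ j → DetR.sign-cong (toℕ j) (begin
    (M zero j ⊛ DetP.det n (DetP.minor M j)) (sumℕ d)
      ≡⟨ ≡.cong (M zero j ⊛ DetP.det n (DetP.minor M j)) (sumℕ-remove {i = j} d) ⟩
    (M zero j ⊛ DetP.det n (DetP.minor M j)) (d j ℕ.+ sumℕ (d ∘ punchIn j))
      ≈⟨ *P-top (M zero j) _ (M≤d zero j) (det-deg≤ n (DetP.minor M j) (d ∘ punchIn j) (minor≤d j)) ⟩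
    M zero j (d j) * DetP.det n (DetP.minor M j) (sumℕ (d ∘ punchIn j))
      ≈⟨ *-congˡ (det-top n (DetP.minor M j) (d ∘ punchIn j) (minor≤d j)) ⟩
    M zero j (d j) * DetR.det n (λ i k → M (suc i) (punchIn j k) (d (punchIn j k))) ∎))
    where
    minor≤d : ∀ j i k → Deg≤ (DetP.minor M j i k) (d (punchIn j k))
    minor≤d j i k = M≤d (suc i) (punchIn j k)

  prodFin-mono : ∀ k (f : Fin k → Carrier) → DetP.prodFin (λ i → mono R (f i) 0) ≈P mono R (DetR.prodFin f) 0
  prodFin-mono zero    f zero    = refl
  prodFin-mono zero    f (suc m) = refl
  prodFin-mono (suc k) f = PR.trans (*P-cong {mono R (f zero) 0} (λ _ → refl) (prodFin-mono k (f ∘ suc)))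
                                    (mono-* (f zero) 0 (DetR.prodFin (f ∘ suc)) 0)

suc-C2 : ∀ x → suc x C 2 ≡ x ℕ.+ x C 2
suc-C2 x = ≡.trans (≡.sym (nCk+nC[k+1]≡[n+1]C[k+1] x 1)) (≡.cong (ℕ._+ x C 2) (nC1≡n x))

module Powers {c ℓ : Level} (R : CommutativeRing c ℓ) where
  open CommutativeRing R hiding (zero)
  open import Algebra.Properties.CommutativeSemigroup *-commutativeSemigroup using (interchange; xy∙z≈xz∙y)

  pow-+ : ∀ x a b → pow R x (a ℕ.+ b) ≈ pow R x a * pow R x b
  pow-+ x zero    b = sym (*-identityˡ _)
  pow-+ x (suc a) b = trans (*-congʳ (pow-+ x a b)) (xy∙z≈xz∙y _ _ _)

  pow-double : ∀ x k → pow R x (2 ℕ.* k) ≈ pow R x k * pow R x k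
  pow-double x k = trans (pow-+ x k (k ℕ.+ 0)) (*-congˡ (reflexive (≡.cong (pow R x) (ℕ.+-identityʳ k))))

module GaussianCoefficients {c ℓ : Level} (R : CommutativeRing c ℓ) (q : CommutativeRing.Carrier R) where
  open CommutativeRing R hiding (zero)
  open Sums R
  open Powers R
  open import Relation.Binary.Reasoning.Setoid setoid
  open import Algebra.Solver.Ring.NaturalCoefficients.Default commutativeSemiring using (solve; _:+_; _:*_; _:=_)

  qbinom-> : ∀ n k → n ℕ.< k → qbinom R q n k ≈ 0#
  qbinom-> zero    (suc k) _           = refl
  qbinom-> (suc n) (suc k) (ℕ.s≤s n<k) =
    trans (+-cong (qbinom-> n k n<k) (trans (*-congˡ (qbinom-> n (suc k) (ℕ.m<n⇒m<1+n n<k))) (zeroʳ _))) (+-identityˡ 0#)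

  qbinom-0 : ∀ n → qbinom R q n 0 ≈ 1#
  qbinom-0 zero    = refl
  qbinom-0 (suc n) = refl

  qbinom-diag : ∀ n → qbinom R q n n ≈ 1#
  qbinom-diag zero    = refl
  qbinom-diag (suc n) = trans (+-cong (qbinom-diag n) (trans (*-congˡ (qbinom-> n (suc n) (ℕ.n<1+n n))) (zeroʳ _)))
                              (+-identityʳ _)

  -- The coefficient of α_l x^(i-l) in α̃_i.
  tildeCoeff : ℕ → ℕ → Carrier
  tildeCoeff i l = pow R q (l C 2) * qbinom R q i l

  tildeCoeff-0 : ∀ i → tildeCoeff i 0 ≈ 1#
  tildeCoeff-0 i = trans (*-identityˡ _) (qbinom-0 i)

  tildeCoeff-> : ∀ i l → i ℕ.< l → tildeCoeff i l ≈ 0#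
  tildeCoeff-> i l i<l = trans (*-congˡ (qbinom-> i l i<l)) (zeroʳ _)

  tildeCoeff-diag : ∀ i → tildeCoeff i i ≈ pow R q (i C 2)
  tildeCoeff-diag i = trans (*-congˡ (qbinom-diag i)) (*-identityʳ _)

  tildeCoeff-pascal : ∀ n x → tildeCoeff (suc n) (suc x) ≈ pow R q x * tildeCoeff n x + pow R q (suc x) * tildeCoeff n (suc x)
  tildeCoeff-pascal n x = begin
    pow R q (suc x C 2) * (qbinom R q n x + pow R q (suc x) * qbinom R q n (suc x))
      ≈⟨ *-congʳ q^C2 ⟩
    (pow R q x * pow R q (x C 2)) * (qbinom R q n x + pow R q (suc x) * qbinom R q n (suc x))
      ≈⟨ solve 5 (λ a b u v w → ((a :* b) :* (u :+ (v :* w))) := ((a :* (b :* u)) :+ (v :* ((a :* b) :* w)))) refl _ _ _ _ _ ⟩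
    pow R q x * tildeCoeff n x + pow R q (suc x) * ((pow R q x * pow R q (x C 2)) * qbinom R q n (suc x))
      ≈⟨ +-congˡ (*-congˡ (*-congʳ (sym q^C2))) ⟩
    pow R q x * tildeCoeff n x + pow R q (suc x) * tildeCoeff n (suc x) ∎
    where
    q^C2 : pow R q (suc x C 2) ≈ pow R q x * pow R q (x C 2)
    q^C2 = trans (reflexive (≡.cong (pow R q) (suc-C2 x))) (pow-+ q x (x C 2))

  vandermondeSum : ℕ → ℕ → ℕ → Carrier
  vandermondeSum i j l = sumTo R (suc l) (λ a → tildeCoeff i (l ∸ a) * pow R q (i ℕ.* a) * tildeCoeff j a)

  q-vandermonde : ∀ i j l → vandermondeSum i j l ≈ tildeCoeff (i ℕ.+ j) l
  q-vandermonde zero j l = begin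
    vandermondeSum 0 j l                      ≈⟨ sumTo-single (suc l) _ l (ℕ.n<1+n l) lower ⟩
    tildeCoeff 0 (l ∸ l) * 1# * tildeCoeff j l ≈⟨ *-congʳ (trans (*-identityʳ _)
                                                   (trans (reflexive (≡.cong (tildeCoeff 0) (ℕ.n∸n≡0 l))) (tildeCoeff-0 0))) ⟩
    1# * tildeCoeff j l                       ≈⟨ *-identityˡ _ ⟩
    tildeCoeff j l                            ∎
    where
    lower : ∀ a → a ℕ.< suc l → a ≢ l → tildeCoeff 0 (l ∸ a) * 1# * tildeCoeff j a ≈ 0#
    lower a a≤l a≢l = trans (*-congʳ (trans (*-congʳ (tildeCoeff-> 0 (l ∸ a)
      (ℕ.m<n⇒0<n∸m (ℕ.≤∧≢⇒< (ℕ.≤-pred a≤l) a≢l)))) (zeroˡ _))) (zeroˡ _)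
  q-vandermonde (suc i) j zero = begin
    0# + tildeCoeff (suc i) 0 * pow R q (suc i ℕ.* 0) * tildeCoeff j 0
      ≈⟨ +-identityˡ _ ⟩
    tildeCoeff (suc i) 0 * pow R q (suc i ℕ.* 0) * tildeCoeff j 0
      ≈⟨ *-cong (*-cong (tildeCoeff-0 (suc i)) (reflexive (≡.cong (pow R q) (ℕ.*-zeroʳ (suc i))))) (tildeCoeff-0 j) ⟩
    1# * 1# * 1#
      ≈⟨ trans (*-identityʳ _) (*-identityʳ _) ⟩
    1#
      ≈⟨ tildeCoeff-0 (suc (i ℕ.+ j)) ⟨
    tildeCoeff (suc i ℕ.+ j) 0 ∎
  q-vandermonde (suc i) j (suc l) = begin
    sumTo R (suc l) T + T (suc l)
      ≈⟨ +-cong (sumTo-cong (suc l) (λ a a≤l → split a (ℕ.≤-pred a≤l))) last ⟩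
    sumTo R (suc l) (λ a → pow R q l * X a + pow R q (suc l) * Y a) + pow R q (suc l) * Y (suc l)
      ≈⟨ +-congʳ (sumTo-+ (suc l) _ _) ⟩
    (sumTo R (suc l) (λ a → pow R q l * X a) + sumTo R (suc l) (λ a → pow R q (suc l) * Y a)) + pow R q (suc l) * Y (suc l)
      ≈⟨ +-assoc _ _ _ ⟩
    sumTo R (suc l) (λ a → pow R q l * X a) + (sumTo R (suc l) (λ a → pow R q (suc l) * Y a) + pow R q (suc l) * Y (suc l))
      ≈⟨ +-cong (sumTo-*ˡ (suc l) (pow R q l) X) (trans (+-congʳ (sumTo-*ˡ (suc l) (pow R q (suc l)) Y)) (sym (distribˡ _ _ _))) ⟩
    pow R q l * vandermondeSum i j l + pow R q (suc l) * vandermondeSum i j (suc l)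
      ≈⟨ +-cong (*-congˡ (q-vandermonde i j l)) (*-congˡ (q-vandermonde i j (suc l))) ⟩
    pow R q l * tildeCoeff (i ℕ.+ j) l + pow R q (suc l) * tildeCoeff (i ℕ.+ j) (suc l)
      ≈⟨ tildeCoeff-pascal (i ℕ.+ j) l ⟨
    tildeCoeff (suc i ℕ.+ j) (suc l) ∎
    where
    T X Y : ℕ → Carrier
    T a = tildeCoeff (suc i) (suc l ∸ a) * pow R q (suc i ℕ.* a) * tildeCoeff j a
    X a = tildeCoeff i (l ∸ a) * pow R q (i ℕ.* a) * tildeCoeff j a
    Y a = tildeCoeff i (suc l ∸ a) * pow R q (i ℕ.* a) * tildeCoeff j a
    q^[1+i]a : ∀ a → pow R q (suc i ℕ.* a) ≈ pow R q a * pow R q (i ℕ.* a)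
    q^[1+i]a a = pow-+ q a (i ℕ.* a)
    split : ∀ a → a ℕ.≤ l → T a ≈ pow R q l * X a + pow R q (suc l) * Y a
    split a a≤l = begin
      tildeCoeff (suc i) (suc l ∸ a) * pow R q (suc i ℕ.* a) * tildeCoeff j a
        ≡⟨ ≡.cong (λ m → tildeCoeff (suc i) m * pow R q (suc i ℕ.* a) * tildeCoeff j a) (ℕ.+-∸-assoc 1 a≤l) ⟩
      tildeCoeff (suc i) (suc (l ∸ a)) * pow R q (suc i ℕ.* a) * tildeCoeff j a
        ≈⟨ *-congʳ (*-cong (tildeCoeff-pascal i (l ∸ a)) (q^[1+i]a a)) ⟩
      (pow R q (l ∸ a) * tildeCoeff i (l ∸ a) + pow R q (suc (l ∸ a)) * tildeCoeff i (suc (l ∸ a)))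
        * (pow R q a * pow R q (i ℕ.* a)) * tildeCoeff j a
        ≈⟨ solve 7 (λ A B C D E F G → (((A :* B) :+ (C :* D)) :* (E :* F) :* G) :=
                                       (((A :* E) :* ((B :* F) :* G)) :+ ((C :* E) :* ((D :* F) :* G)))) refl _ _ _ _ _ _ _ ⟩
      (pow R q (l ∸ a) * pow R q a) * X a
        + (pow R q (suc (l ∸ a)) * pow R q a) * (tildeCoeff i (suc (l ∸ a)) * pow R q (i ℕ.* a) * tildeCoeff j a)
        ≈⟨ +-cong (*-congʳ (trans (sym (pow-+ q (l ∸ a) a)) (reflexive (≡.cong (pow R q) (ℕ.m∸n+n≡m a≤l)))))
                  (*-cong (trans (sym (pow-+ q (suc (l ∸ a)) a)) (reflexive (≡.cong (pow R q ∘ suc) (ℕ.m∸n+n≡m a≤l))))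
                          (reflexive (≡.cong (λ m → tildeCoeff i m * pow R q (i ℕ.* a) * tildeCoeff j a) (≡.sym (ℕ.+-∸-assoc 1 a≤l))))) ⟩
      pow R q l * X a + pow R q (suc l) * Y a ∎
    last : T (suc l) ≈ pow R q (suc l) * Y (suc l)
    last = begin
      tildeCoeff (suc i) (suc l ∸ suc l) * pow R q (suc i ℕ.* suc l) * tildeCoeff j (suc l)
        ≈⟨ *-congʳ (*-cong (trans (reflexive (≡.cong (tildeCoeff (suc i)) (ℕ.n∸n≡0 l))) (tildeCoeff-0 (suc i))) (q^[1+i]a (suc l))) ⟩
      1# * (pow R q (suc l) * pow R q (i ℕ.* suc l)) * tildeCoeff j (suc l)
        ≈⟨ *-congʳ (*-congʳ (sym (trans (reflexive (≡.cong (tildeCoeff i) (ℕ.n∸n≡0 l))) (tildeCoeff-0 i)))) ⟩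
      tildeCoeff i (suc l ∸ suc l) * (pow R q (suc l) * pow R q (i ℕ.* suc l)) * tildeCoeff j (suc l)
        ≈⟨ solve 4 (λ A B C D → ((A :* (B :* C)) :* D) := (B :* ((A :* C) :* D))) refl _ _ _ _ ⟩
      pow R q (suc l) * Y (suc l) ∎

private
  ∸-+-interchange : ∀ {i j a t} → a ℕ.≤ i → t ℕ.≤ j → (i ∸ a) ℕ.+ (j ∸ t) ≡ (i ℕ.+ j) ∸ (a ℕ.+ t)
  ∸-+-interchange {i} {j} {a} {t} a≤i t≤j with ℕ.m≤n⇒∃[o]m+o≡n a≤i | ℕ.m≤n⇒∃[o]m+o≡n t≤j
  ... | i′ , ≡.refl | j′ , ≡.refl = begin
    (a ℕ.+ i′ ∸ a) ℕ.+ (t ℕ.+ j′ ∸ t)          ≡⟨ ≡.cong₂ ℕ._+_ (ℕ.m+n∸m≡n a i′) (ℕ.m+n∸m≡n t j′) ⟩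
    i′ ℕ.+ j′                                  ≡⟨ ℕ.m+n∸m≡n (a ℕ.+ t) (i′ ℕ.+ j′) ⟨
    (a ℕ.+ t) ℕ.+ (i′ ℕ.+ j′) ∸ (a ℕ.+ t)      ≡⟨ ≡.cong (_∸ (a ℕ.+ t)) (interchange a t i′ j′) ⟩
    (a ℕ.+ i′) ℕ.+ (t ℕ.+ j′) ∸ (a ℕ.+ t)      ∎
    where
    open ≡.≡-Reasoning
    open import Algebra.Properties.CommutativeSemigroup ℕ.+-commutativeSemigroup using (interchange)

module Factorisation {c ℓ : Level} (R : CommutativeRing c ℓ) (q : CommutativeRing.Carrier R) (α : ℕ → CommutativeRing.Carrier R) where
  open CommutativeRing R hiding (zero)
  open Sums R
  open Powers R
  open GaussianCoefficients R q
  open Polynomials R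

  lowerFactor : ℕ → ℕ → Poly R
  lowerFactor i a = mono R (tildeCoeff i a) (i ∸ a)

  upperCoeff : ℕ → ℕ → ℕ → Carrier
  upperCoeff a j t = pow R q (j ℕ.* a) * tildeCoeff j t * α (a ℕ.+ t)

  upperFactor : ℕ → ℕ → Poly R
  upperFactor a j = sumTo polyRing (suc j) (λ t → mono R (upperCoeff a j t) (j ∸ t))

  lowerFactor-upper : ∀ {i a} → i ℕ.< a → lowerFactor i a ≈P 0P R
  lowerFactor-upper {i} {a} i<a = mono-zero (i ∸ a) (tildeCoeff-> i a i<a)

  lowerFactor-diag : ∀ i → lowerFactor i i ≈P mono R (pow R q (i C 2)) 0
  lowerFactor-diag i m = trans (reflexive (≡.cong (λ d → mono R (tildeCoeff i i) d m) (ℕ.n∸n≡0 i)))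
                               (mono-cong 0 (tildeCoeff-diag i) m)

  upperFactor-deg≤ : ∀ a j → Deg≤ (upperFactor a j) j
  upperFactor-deg≤ a j m j<m = trans (reflexive (sumToP-eval (suc j) _ m))
    (sumTo-zero (suc j) (λ t _ → mono-≢ _ (ℕ.<⇒≢ (ℕ.≤-<-trans (ℕ.m∸n≤m j t) j<m))))

  upperFactor-top : ∀ a j → upperFactor a j j ≈ pow R q (j ℕ.* a) * α a
  upperFactor-top a j = begin
    upperFactor a j j                           ≡⟨ sumToP-eval (suc j) _ j ⟩
    sumTo R (suc j) (λ t → mono R (upperCoeff a j t) (j ∸ t) j)
      ≈⟨ sumTo-single (suc j) _ 0 (ℕ.s≤s ℕ.z≤n) (λ t t≤j t≢0 → mono-≢ _ (ℕ.<⇒≢ (ℕ.∸-monoʳ-< (ℕ.n≢0⇒n>0 t≢0) (ℕ.≤-pred t≤j)))) ⟩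
    mono R (upperCoeff a j 0) j j               ≈⟨ mono-≡ _ j ⟩
    pow R q (j ℕ.* a) * tildeCoeff j 0 * α (a ℕ.+ 0)
      ≈⟨ *-cong (trans (*-congˡ (tildeCoeff-0 j)) (*-identityʳ _)) (reflexive (≡.cong α (ℕ.+-identityʳ a))) ⟩
    pow R q (j ℕ.* a) * α a                     ∎
    where
    open import Relation.Binary.Reasoning.Setoid setoid

  open import Algebra.Solver.Ring.NaturalCoefficients.Default commutativeSemiring using (solve; _:*_; _:=_)

  convCoeff : ℕ → ℕ → ℕ → ℕ → Carrier
  convCoeff i j a l = tildeCoeff i a * (pow R q (j ℕ.* a) * tildeCoeff j (l ∸ a) * α l)

  tildeCoeff-convolution : ∀ i j l → tildeCoeff (i ℕ.+ j) l * α l ≈ sumTo R (suc l) (λ a → convCoeff i j a l)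
  tildeCoeff-convolution i j l = begin
    tildeCoeff (i ℕ.+ j) l * α l     ≡⟨ ≡.cong (λ k → tildeCoeff k l * α l) (ℕ.+-comm i j) ⟩
    tildeCoeff (j ℕ.+ i) l * α l     ≈⟨ *-congʳ (q-vandermonde j i l) ⟨
    vandermondeSum j i l * α l       ≈⟨ sumTo-*ʳ (suc l) (α l) _ ⟨
    sumTo R (suc l) (λ a → tildeCoeff j (l ∸ a) * pow R q (j ℕ.* a) * tildeCoeff i a * α l)
      ≈⟨ sumTo-cong (suc l) (λ a _ → solve 4 (λ A B C D → (((A :* B) :* C) :* D) := (C :* ((B :* A) :* D))) refl _ _ _ _) ⟩
    sumTo R (suc l) (λ a → convCoeff i j a l) ∎
    where open import Relation.Binary.Reasoning.Setoid setoid

  alphaTilde-extend : ∀ k K → k ℕ.< K → alphaTilde R q α k ≈P sumTo polyRing K (λ l → mono R (tildeCoeff k l * α l) (k ∸ l))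
  alphaTilde-extend k K k<K m = trans (reflexive (≡.sym (sumToP-eval (suc k) _ m)))
    (sym (SumsP.sumTo-extend (suc k) K _ k<K (λ l k<l → mono-zero (k ∸ l) (trans (*-congʳ (tildeCoeff-> k l k<l)) (zeroˡ _))) m))

  module _ (N i j : ℕ) (i<N : i ℕ.< N) where

    private
      F : ℕ → ℕ → Poly R
      F a l = mono R (convCoeff i j a l) ((i ℕ.+ j) ∸ l)

      inner : ℕ → ℕ → Poly R
      inner a n = sumTo polyRing n (λ t → F a (a ℕ.+ t))

    regroup : sumTo polyRing (N ℕ.+ j) (λ l → sumTo polyRing (suc l) (λ a → F a l)) ≈P
              sumTo polyRing N (λ a → inner a (suc j))
    regroup = begin
      sumTo polyRing (N ℕ.+ j) (λ l → sumTo polyRing (suc l) (λ a → F a l))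
        ≈⟨ SumsP.sumTo-triangle (N ℕ.+ j) F ⟩
      sumTo polyRing (N ℕ.+ j) (λ a → inner a (N ℕ.+ j ∸ a))
        ≈⟨ SumsP.sumTo-extend N (N ℕ.+ j) (λ a → inner a (N ℕ.+ j ∸ a)) (ℕ.m≤m+n N j) beyond-i ⟩
      sumTo polyRing N (λ a → inner a (N ℕ.+ j ∸ a))
        ≈⟨ SumsP.sumTo-cong N (λ a a<N → SumsP.sumTo-extend (suc j) (N ℕ.+ j ∸ a) (λ t → F a (a ℕ.+ t)) (suc-j≤ a<N) (beyond-j a)) ⟩
      sumTo polyRing N (λ a → inner a (suc j)) ∎
      where
      open import Relation.Binary.Reasoning.Setoid PR.setoid
      beyond-i : ∀ a → N ℕ.≤ a → inner a (N ℕ.+ j ∸ a) ≈P 0P R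
      beyond-i a N≤a = SumsP.sumTo-zero (N ℕ.+ j ∸ a) (λ t _ → mono-zero ((i ℕ.+ j) ∸ (a ℕ.+ t))
        (trans (*-congʳ (tildeCoeff-> i a (ℕ.<-≤-trans i<N N≤a))) (zeroˡ _)))
      beyond-j : ∀ a t → suc j ℕ.≤ t → F a (a ℕ.+ t) ≈P 0P R
      beyond-j a t j<t = mono-zero ((i ℕ.+ j) ∸ (a ℕ.+ t)) (trans (*-congˡ (trans (*-congʳ (trans (*-congˡ
        (trans (reflexive (≡.cong (tildeCoeff j) (ℕ.m+n∸m≡n a t))) (tildeCoeff-> j t j<t))) (zeroʳ _))) (zeroˡ _))) (zeroʳ _))
      suc-j≤ : ∀ {a} → a ℕ.< N → suc j ℕ.≤ N ℕ.+ j ∸ a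
      suc-j≤ a<N = ≡.subst (suc j ℕ.≤_) (≡.sym (ℕ.+-∸-comm j (ℕ.<⇒≤ a<N))) (ℕ.+-monoˡ-≤ j (ℕ.m<n⇒0<n∸m a<N))

    shifted-term : ∀ a t → t ℕ.≤ j → F a (a ℕ.+ t) ≈P mono R (tildeCoeff i a * upperCoeff a j t) ((i ∸ a) ℕ.+ (j ∸ t))
    shifted-term a t t≤j with a ℕ.≤? i
    ... | yes a≤i = λ m → trans (mono-cong ((i ℕ.+ j) ∸ (a ℕ.+ t)) same-coeff m)
                                (reflexive (≡.cong (λ d → mono R (tildeCoeff i a * upperCoeff a j t) d m) (≡.sym (∸-+-interchange a≤i t≤j))))
      where
      same-coeff : convCoeff i j a (a ℕ.+ t) ≈ tildeCoeff i a * upperCoeff a j t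
      same-coeff = reflexive (≡.cong (λ s → tildeCoeff i a * (pow R q (j ℕ.* a) * tildeCoeff j s * α (a ℕ.+ t))) (ℕ.m+n∸m≡n a t))
    ... | no a≰i = λ m → trans (mono-zero ((i ℕ.+ j) ∸ (a ℕ.+ t)) (lower-zero _) m)
                               (sym (mono-zero ((i ∸ a) ℕ.+ (j ∸ t)) (lower-zero (upperCoeff a j t)) m))
      where
      lower-zero : ∀ x → tildeCoeff i a * x ≈ 0#
      lower-zero x = trans (*-congʳ (tildeCoeff-> i a (ℕ.≰⇒> a≰i))) (zeroˡ x)

  lowerFactor-*-upperFactor : ∀ i a j → (lowerFactor i a ⊛ upperFactor a j) ≈P
    sumTo polyRing (suc j) (λ t → mono R (tildeCoeff i a * upperCoeff a j t) ((i ∸ a) ℕ.+ (j ∸ t)))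
  lowerFactor-*-upperFactor i a j = PR.trans
    (PR.sym (SumsP.sumTo-*ˡ (suc j) (lowerFactor i a) (λ t → mono R (upperCoeff a j t) (j ∸ t))))
    (SumsP.sumTo-cong (suc j) (λ t _ → mono-* (tildeCoeff i a) (i ∸ a) (upperCoeff a j t) (j ∸ t)))

  alphaTilde-factorisation : ∀ N i j → i ℕ.< N →
    alphaTilde R q α (i ℕ.+ j) ≈P sumTo polyRing N (λ a → lowerFactor i a ⊛ upperFactor a j)
  alphaTilde-factorisation N i j i<N = begin
    alphaTilde R q α (i ℕ.+ j)
      ≈⟨ alphaTilde-extend (i ℕ.+ j) (N ℕ.+ j) (ℕ.+-monoˡ-< j i<N) ⟩
    sumTo polyRing (N ℕ.+ j) (λ l → mono R (tildeCoeff (i ℕ.+ j) l * α l) ((i ℕ.+ j) ∸ l))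
      ≈⟨ SumsP.sumTo-cong (N ℕ.+ j) (λ l _ → mono-cong ((i ℕ.+ j) ∸ l) (tildeCoeff-convolution i j l)) ⟩
    sumTo polyRing (N ℕ.+ j) (λ l → mono R (sumTo R (suc l) (λ a → convCoeff i j a l)) ((i ℕ.+ j) ∸ l))
      ≈⟨ SumsP.sumTo-cong (N ℕ.+ j) (λ l _ → sumTo-mono (suc l) (λ a → convCoeff i j a l) ((i ℕ.+ j) ∸ l)) ⟨
    sumTo polyRing (N ℕ.+ j) (λ l → sumTo polyRing (suc l) (λ a → mono R (convCoeff i j a l) ((i ℕ.+ j) ∸ l)))
      ≈⟨ regroup N i j i<N ⟩
    sumTo polyRing N (λ a → sumTo polyRing (suc j) (λ t → mono R (convCoeff i j a (a ℕ.+ t)) ((i ℕ.+ j) ∸ (a ℕ.+ t))))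
      ≈⟨ SumsP.sumTo-cong N (λ a _ → SumsP.sumTo-cong (suc j) (λ t t<1+j → shifted-term N i j i<N a t (ℕ.≤-pred t<1+j))) ⟩
    sumTo polyRing N (λ a → sumTo polyRing (suc j) (λ t → mono R (tildeCoeff i a * upperCoeff a j t) ((i ∸ a) ℕ.+ (j ∸ t))))
      ≈⟨ SumsP.sumTo-cong N (λ a _ → lowerFactor-*-upperFactor i a j) ⟨
    sumTo polyRing N (λ a → lowerFactor i a ⊛ upperFactor a j) ∎
    where open import Relation.Binary.Reasoning.Setoid PR.setoid

module Products {c ℓ : Level} (R : CommutativeRing c ℓ) where
  open CommutativeRing R hiding (zero)
  open import Algebra.Properties.CommutativeSemigroup *-commutativeSemigroup using (interchange)
  open Determinant R using (prodFin)

  prodTo-cong : ∀ n {f g : ℕ → Carrier} → (∀ i → i ℕ.< n → f i ≈ g i) → prodTo R n f ≈ prodTo R n g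
  prodTo-cong zero    f≈g = refl
  prodTo-cong (suc n) f≈g = *-cong (prodTo-cong n (λ i i<n → f≈g i (ℕ.m<n⇒m<1+n i<n))) (f≈g n (ℕ.n<1+n n))

  prodTo-* : ∀ n (f g : ℕ → Carrier) → prodTo R n (λ i → f i * g i) ≈ prodTo R n f * prodTo R n g
  prodTo-* zero    f g = sym (*-identityˡ 1#)
  prodTo-* (suc n) f g = trans (*-congʳ (prodTo-* n f g)) (interchange _ _ _ _)

  prodTo-const : ∀ n a → prodTo R n (λ _ → a) ≈ pow R a n
  prodTo-const zero    a = refl
  prodTo-const (suc n) a = *-congʳ (prodTo-const n a)

  prodTo-suc : ∀ n (f : ℕ → Carrier) → prodTo R (suc n) f ≈ f 0 * prodTo R n (f ∘ suc)
  prodTo-suc zero    f = trans (*-identityˡ _) (sym (*-identityʳ _))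
  prodTo-suc (suc n) f = trans (*-congʳ (prodTo-suc n f)) (*-assoc _ _ _)

  prodFin-toℕ : ∀ n (f : ℕ → Carrier) → prodFin (f ∘ toℕ {n}) ≈ prodTo R n f
  prodFin-toℕ zero    f = refl
  prodFin-toℕ (suc n) f = trans (*-congˡ (prodFin-toℕ n (f ∘ suc))) (sym (prodTo-suc n f))

suc-C3 : ∀ m → suc m C 3 ≡ m C 2 ℕ.+ m C 3
suc-C3 m = ≡.sym (nCk+nC[k+1]≡[n+1]C[k+1] m 2)

module QVandermonde {c ℓ : Level} (R : CommutativeRing c ℓ) (q : CommutativeRing.Carrier R) where
  open CommutativeRing R hiding (zero)
  open import Algebra.Properties.Ring ring using (-1*x≈-x; -‿involutive)
  open import Algebra.Properties.CommutativeSemigroup *-commutativeSemigroup using (x∙yz≈y∙xz)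
  open import Relation.Binary.Reasoning.Setoid setoid
  open Determinant R
  open Sums R
  open Powers R
  open Products R

  vandermonde : ℕ → Carrier
  vandermonde N = det N (λ a j → pow R q (toℕ j ℕ.* toℕ a))

  difference : ℕ → ℕ → Carrier
  difference zero    j = pow R q (j ℕ.* 0)
  difference (suc a) j = pow R q (j ℕ.* suc a) - pow R q (j ℕ.* a)

  difference-telescope : ∀ a j → sumTo R (suc a) (λ b → difference b j) ≈ pow R q (j ℕ.* a)
  difference-telescope zero    j = +-identityˡ _
  difference-telescope (suc a) j = begin
    sumTo R (suc a) (λ b → difference b j) + (y - x)    ≈⟨ +-congʳ (difference-telescope a j) ⟩
    x + (y - x)                                          ≈⟨ +-congˡ (+-comm _ _) ⟩
    x + (- x + y)                                        ≈⟨ +-assoc _ _ _ ⟨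
    (x - x) + y                                          ≈⟨ +-congʳ (-‿inverseʳ _) ⟩
    0# + y                                               ≈⟨ +-identityˡ _ ⟩
    y                                                    ∎
    where
    x = pow R q (j ℕ.* a)
    y = pow R q (j ℕ.* suc a)

  -- Subtracting from each row the previous one is a unitriangular row operation.
  vandermonde-differences : ∀ N → vandermonde N ≈ det N (λ a j → difference (toℕ a) (toℕ j))
  vandermonde-differences N = begin
    vandermonde N
      ≈⟨ det-cong N (λ a j → sym (trans (sumFin-toℕ N _) (partial-sum (toℕ a) (toℕ j) (Fin.toℕ<n a)))) ⟩
    det N (λ a j → sumFin N (λ b → E a b * difference (toℕ b) (toℕ j)))
      ≈⟨ det-lowerTriangular-* E (λ b j → difference (toℕ b) (toℕ j)) (λ a b a<b → reflexive (≡.cong (if_then 1# else 0#) (dec-false (toℕ b ℕ.≤? toℕ a) (ℕ.<⇒≱ a<b)))) ⟩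
    prodFin (λ a → E a a) * det N (λ a j → difference (toℕ a) (toℕ j))
      ≈⟨ *-congʳ (trans (prodFin-cong {N} (λ a → reflexive (≡.cong (if_then 1# else 0#) (dec-true (toℕ a ℕ.≤? toℕ a) ℕ.≤-refl)))) (prodFin-replicate-1 N)) ⟩
    1# * det N (λ a j → difference (toℕ a) (toℕ j))
      ≈⟨ *-identityˡ _ ⟩
    det N (λ a j → difference (toℕ a) (toℕ j)) ∎
    where
    E : Mat N
    E a b = if does (toℕ b ℕ.≤? toℕ a) then 1# else 0#
    partial-sum : ∀ a j → a ℕ.< N → sumTo R N (λ b → (if does (b ℕ.≤? a) then 1# else 0#) * difference b j) ≈ pow R q (j ℕ.* a)
    partial-sum a j a<N = begin
      sumTo R N (λ b → (if does (b ℕ.≤? a) then 1# else 0#) * difference b j)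
        ≈⟨ sumTo-extend (suc a) N _ a<N (λ b a<b → trans (*-congʳ (reflexive (≡.cong (if_then 1# else 0#) (dec-false (b ℕ.≤? a) (ℕ.<⇒≱ a<b))))) (zeroˡ _)) ⟩
      sumTo R (suc a) (λ b → (if does (b ℕ.≤? a) then 1# else 0#) * difference b j)
        ≈⟨ sumTo-cong (suc a) (λ b b≤a → trans (*-congʳ (reflexive (≡.cong (if_then 1# else 0#) (dec-true (b ℕ.≤? a) (ℕ.≤-pred b≤a))))) (*-identityˡ _)) ⟩
      sumTo R (suc a) (λ b → difference b j)
        ≈⟨ difference-telescope a j ⟩
      pow R q (j ℕ.* a) ∎

  difference-suc : ∀ i k → difference (suc i) (suc k) ≈ pow R q i * ((pow R q (suc k) - 1#) * pow R q (k ℕ.* i))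
  difference-suc i k = begin
    pow R q (suc k ℕ.* suc i) - pow R q (suc k ℕ.* i)   ≡⟨ ≡.cong (λ e → pow R q e - pow R q (suc k ℕ.* i)) (ℕ.*-suc (suc k) i) ⟩
    pow R q (suc k ℕ.+ suc k ℕ.* i) - y                 ≈⟨ +-congʳ (pow-+ q (suc k) (suc k ℕ.* i)) ⟩
    x * y - y                                           ≈⟨ +-congˡ (-1*x≈-x y) ⟨
    x * y + (- 1#) * y                                  ≈⟨ distribʳ y x (- 1#) ⟨
    (x - 1#) * y                                        ≈⟨ *-congˡ (pow-+ q i (k ℕ.* i)) ⟩
    (x - 1#) * (pow R q i * pow R q (k ℕ.* i))          ≈⟨ x∙yz≈y∙xz _ _ _ ⟩
    pow R q i * ((x - 1#) * pow R q (k ℕ.* i))          ∎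
    where
    x = pow R q (suc k)
    y = pow R q (suc k ℕ.* i)

  det-minor-zero-col : ∀ {n} (M : Mat (suc n)) (j : Fin n) → (∀ i → M (suc i) zero ≈ 0#) → det n (minor M (suc j)) ≈ 0#
  det-minor-zero-col {suc n} M j M₀≈0 = det-zero-col (suc n) (minor M (suc j)) zero M₀≈0

  -- The difference matrix has first column (1, 0, …, 0), and its remaining block is a
  -- Vandermonde matrix with rescaled rows and columns.
  vandermonde-suc : ∀ n →
    vandermonde (suc n) ≈ prodFin {n} (λ i → pow R q (toℕ i)) * (prodFin {n} (λ k → pow R q (suc (toℕ k)) - 1#) * vandermonde n)
  vandermonde-suc n = begin
    vandermonde (suc n)
      ≈⟨ vandermonde-differences (suc n) ⟩
    det (suc n) D
      ≈⟨ sumFin-single (suc n) _ zero first-row ⟩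
    D zero zero * det n (minor D zero)
      ≈⟨ *-identityˡ _ ⟩
    det n (minor D zero)
      ≈⟨ det-cong n (λ i k → difference-suc (toℕ i) (toℕ k)) ⟩
    det n (λ i k → pow R q (toℕ i) * ((pow R q (suc (toℕ k)) - 1#) * pow R q (toℕ k ℕ.* toℕ i)))
      ≈⟨ det-row-scale n _ _ ⟩
    prodFin {n} (λ i → pow R q (toℕ i)) * det n (λ i k → (pow R q (suc (toℕ k)) - 1#) * pow R q (toℕ k ℕ.* toℕ i))
      ≈⟨ *-congˡ (det-col-scale n _ _) ⟩
    prodFin {n} (λ i → pow R q (toℕ i)) * (prodFin {n} (λ k → pow R q (suc (toℕ k)) - 1#) * vandermonde n) ∎
    where
    D : Mat (suc n)
    D a j = difference (toℕ a) (toℕ j)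
    first-row : ∀ j → j ≢ zero → sign (toℕ j) (D zero j * det n (minor D j)) ≈ 0#
    first-row zero    j≢0 = ⊥-elim (j≢0 ≡.refl)
    first-row (suc j) _   = trans (sign-cong (toℕ (suc j)) (trans (*-congˡ (det-minor-zero-col D j (λ i → -‿inverseʳ 1#))) (zeroʳ _)))
                                  (sign-0 (toℕ (suc j)))

  qFactor : ℕ → Carrier
  qFactor i = 1# - pow R q (suc i)

  staircase : ℕ → Carrier
  staircase n = prodTo R n (λ i → pow R (qFactor i) (n ∸ i))

  prodTo-q^i : ∀ m → prodTo R m (pow R q) ≈ pow R q (m C 2)
  prodTo-q^i zero    = refl
  prodTo-q^i (suc m) = begin
    prodTo R m (pow R q) * pow R q m    ≈⟨ *-congʳ (prodTo-q^i m) ⟩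
    pow R q (m C 2) * pow R q m         ≈⟨ *-comm _ _ ⟩
    pow R q m * pow R q (m C 2)         ≈⟨ pow-+ q m (m C 2) ⟨
    pow R q (m ℕ.+ m C 2)               ≡⟨ ≡.cong (pow R q) (suc-C2 m) ⟨
    pow R q (suc m C 2)                 ∎

  prodTo-q^C2 : ∀ m → prodTo R m (λ i → pow R q (i C 2)) ≈ pow R q (m C 3)
  prodTo-q^C2 zero    = refl
  prodTo-q^C2 (suc m) = begin
    prodTo R m (λ i → pow R q (i C 2)) * pow R q (m C 2)   ≈⟨ *-congʳ (prodTo-q^C2 m) ⟩
    pow R q (m C 3) * pow R q (m C 2)                      ≈⟨ *-comm _ _ ⟩
    pow R q (m C 2) * pow R q (m C 3)                      ≈⟨ pow-+ q (m C 2) (m C 3) ⟨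
    pow R q (m C 2 ℕ.+ m C 3)                              ≡⟨ ≡.cong (pow R q) (suc-C3 m) ⟨
    pow R q (suc m C 3)                                    ∎

  prodTo-q^[1+k]-1 : ∀ m → prodTo R m (λ k → pow R q (suc k) - 1#) ≈ pow R (- 1#) m * prodTo R m qFactor
  prodTo-q^[1+k]-1 m = begin
    prodTo R m (λ k → pow R q (suc k) - 1#)          ≈⟨ prodTo-cong m (λ k _ → negate (pow R q (suc k))) ⟩
    prodTo R m (λ k → (- 1#) * qFactor k)            ≈⟨ prodTo-* m (λ _ → - 1#) qFactor ⟩
    prodTo R m (λ _ → - 1#) * prodTo R m qFactor     ≈⟨ *-congʳ (prodTo-const m (- 1#)) ⟩
    pow R (- 1#) m * prodTo R m qFactor              ∎
    where
    negate : ∀ y → y - 1# ≈ (- 1#) * (1# - y)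
    negate y = begin
      y - 1#                         ≈⟨ +-comm _ _ ⟩
      - 1# + y                       ≈⟨ +-congˡ (-‿involutive y) ⟨
      - 1# + - (- y)                 ≈⟨ +-cong (sym (*-identityʳ _)) (sym (-1*x≈-x (- y))) ⟩
      (- 1#) * 1# + (- 1#) * (- y)   ≈⟨ distribˡ _ _ _ ⟨
      (- 1#) * (1# - y)              ∎

  staircase-suc : ∀ n → staircase (suc n) ≈ staircase n * prodTo R (suc n) qFactor
  staircase-suc n = begin
    prodTo R n (λ i → pow R (qFactor i) (suc n ∸ i)) * pow R (qFactor n) (suc n ∸ n)
      ≈⟨ *-cong (prodTo-cong n (λ i i<n → reflexive (≡.cong (pow R (qFactor i)) (ℕ.+-∸-assoc 1 (ℕ.<⇒≤ i<n)))))
                (reflexive (≡.cong (pow R (qFactor n)) (≡.trans (ℕ.+-∸-assoc 1 (ℕ.≤-refl {n})) (≡.cong suc (ℕ.n∸n≡0 n))))) ⟩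
    prodTo R n (λ i → pow R (qFactor i) (n ∸ i) * qFactor i) * (1# * qFactor n)
      ≈⟨ *-cong (prodTo-* n _ qFactor) (*-identityˡ _) ⟩
    (staircase n * prodTo R n qFactor) * qFactor n
      ≈⟨ *-assoc _ _ _ ⟩
    staircase n * prodTo R (suc n) qFactor ∎

  vandermonde-closed : ∀ n → vandermonde (suc n) ≈ pow R (- 1#) (suc n C 2) * pow R q (suc n C 3) * staircase n
  vandermonde-closed zero = trans (+-identityʳ _) (trans (*-identityˡ 1#) (sym (trans (*-identityʳ _) (*-identityʳ _))))
  vandermonde-closed (suc n) = begin
    vandermonde (suc (suc n))
      ≈⟨ vandermonde-suc (suc n) ⟩
    prodFin {suc n} (λ i → pow R q (toℕ i)) * (prodFin {suc n} (λ k → pow R q (suc (toℕ k)) - 1#) * vandermonde (suc n))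
      ≈⟨ *-cong (trans (prodFin-toℕ (suc n) (pow R q)) (prodTo-q^i (suc n)))
                (*-cong (trans (prodFin-toℕ (suc n) (λ k → pow R q (suc k) - 1#)) (prodTo-q^[1+k]-1 (suc n)))
                        (vandermonde-closed n)) ⟩
    q₂ * ((s₁ * X) * (s₂ * q₃ * staircase n))
      ≈⟨ solve 6 (λ A B C D E F → (A :* ((B :* C) :* ((D :* E) :* F))) := (((B :* D) :* (A :* E)) :* (F :* C))) refl _ _ _ _ _ _ ⟩
    (s₁ * s₂) * (q₂ * q₃) * (staircase n * X)
      ≈⟨ *-cong (*-cong signs powers) (sym (staircase-suc n)) ⟩
    pow R (- 1#) (suc (suc n) C 2) * pow R q (suc (suc n) C 3) * staircase (suc n) ∎
    where
    open import Algebra.Solver.Ring.NaturalCoefficients.Default commutativeSemiring using (solve; _:*_; _:=_)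
    q₂ = pow R q (suc n C 2)
    q₃ = pow R q (suc n C 3)
    s₁ = pow R (- 1#) (suc n)
    s₂ = pow R (- 1#) (suc n C 2)
    X = prodTo R (suc n) qFactor
    signs : s₁ * s₂ ≈ pow R (- 1#) (suc (suc n) C 2)
    signs = trans (sym (pow-+ (- 1#) (suc n) (suc n C 2))) (reflexive (≡.cong (pow R (- 1#)) (≡.sym (suc-C2 (suc n)))))
    powers : q₂ * q₃ ≈ pow R q (suc (suc n) C 3)
    powers = trans (sym (pow-+ q (suc n C 2) (suc n C 3))) (reflexive (≡.cong (pow R q) (≡.sym (suc-C3 (suc n)))))

triangle : ℕ → ℕ
triangle zero    = 0
triangle (suc n) = n ℕ.+ triangle n

sumℕ-toℕ : ∀ N → sumℕ (toℕ {N}) ≡ triangle N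
sumℕ-toℕ zero    = ≡.refl
sumℕ-toℕ (suc N) = begin
  sumℕ (toℕ {suc N})                              ≡⟨ sumℕ-init-last {N} toℕ ⟩
  sumℕ {N} (toℕ ∘ Fin.inject₁) ℕ.+ toℕ (Fin.fromℕ N)
    ≡⟨ ≡.cong₂ ℕ._+_ (≡.trans (sumℕ-cong-≗ {N} Fin.toℕ-inject₁) (sumℕ-toℕ N)) (Fin.toℕ-fromℕ N) ⟩
  triangle N ℕ.+ N                                ≡⟨ ℕ.+-comm (triangle N) N ⟩
  triangle (suc N)                                ∎
  where open ≡.≡-Reasoning

triangle-double : ∀ n → triangle (suc n) ℕ.* 2 ≡ n ℕ.* suc n
triangle-double zero    = ≡.refl
triangle-double (suc n) = begin
  (suc n ℕ.+ triangle (suc n)) ℕ.* 2           ≡⟨ ℕ.*-distribʳ-+ 2 (suc n) (triangle (suc n)) ⟩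
  suc n ℕ.* 2 ℕ.+ triangle (suc n) ℕ.* 2       ≡⟨ ≡.cong (suc n ℕ.* 2 ℕ.+_) (triangle-double n) ⟩
  suc n ℕ.* 2 ℕ.+ n ℕ.* suc n                  ≡⟨ identity n ⟩
  suc n ℕ.* suc (suc n)                        ∎
  where
  open ≡.≡-Reasoning
  identity : ∀ n → suc n ℕ.* 2 ℕ.+ n ℕ.* suc n ≡ suc n ℕ.* suc (suc n)
  identity = solve-∀

tri≡triangle : ∀ {c ℓ} (R : CommutativeRing c ℓ) n → tri R n ≡ triangle (suc n)
tri≡triangle R n = ≡.trans (≡.cong (_/ 2) (≡.sym (triangle-double n))) (m*n/n≡m (triangle (suc n)) 2)

module HankelDeterminant {c ℓ : Level} (R : CommutativeRing c ℓ) (q : CommutativeRing.Carrier R)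
                         (α : ℕ → CommutativeRing.Carrier R) (n : ℕ) where
  open CommutativeRing R hiding (zero)
  open Powers R
  open GaussianCoefficients R q
  open Polynomials R
  open Factorisation R q α
  open QVandermonde R q using (vandermonde; vandermonde-closed; staircase)
  open Products R using (prodFin-toℕ)
  open import Relation.Binary.Reasoning.Setoid setoid

  private
    N = suc n

  L U : DetP.Mat N
  L i a = lowerFactor (toℕ i) (toℕ a)
  U a j = upperFactor (toℕ a) (toℕ j)

  hankel-factorisation : hankelPoly R q α n ≈P (DetP.prodFin (λ i → L i i) ⊛ DetP.det N U)
  hankel-factorisation = PR.trans (DetP.det-cong N entry) (DetP.det-lowerTriangular-* L U (λ _ _ → lowerFactor-upper))
    where
    entry : ∀ i j → alphaTilde R q α (toℕ i ℕ.+ toℕ j) ≈P DetP.sumFin N (λ a → L i a ⊛ U a j)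
    entry i j = PR.trans (alphaTilde-factorisation N (toℕ i) (toℕ j) (Fin.toℕ<n i))
                         (PR.sym (SumsP.sumFin-toℕ N (λ a → lowerFactor (toℕ i) a ⊛ upperFactor a (toℕ j))))

  diagonal-constant : DetP.prodFin (λ i → L i i) ≈P mono R (pow R q (N C 3)) 0
  diagonal-constant = PR.trans (DetP.prodFin-cong {N} (λ i → lowerFactor-diag (toℕ i)))
    (PR.trans (prodFin-mono N (λ i → pow R q (toℕ i C 2)))
              (mono-cong 0 (trans (prodFin-toℕ N (λ i → pow R q (i C 2))) (QVandermonde.prodTo-q^C2 R q N))))

  hankel-coeff : ∀ m → hankelPoly R q α n m ≈ pow R q (N C 3) * DetP.det N U m
  hankel-coeff m = trans (hankel-factorisation m)
    (trans (*P-cong {DetP.prodFin (λ i → L i i)} {g = DetP.det N U} diagonal-constant (λ _ → refl) m)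
           (const-*P _ (DetP.det N U) m))

  private
    U-deg≤ : ∀ a j → Deg≤ (U a j) (toℕ j)
    U-deg≤ a j = upperFactor-deg≤ (toℕ a) (toℕ j)

  hankel-deg≤ : ∀ m → triangle N < m → hankelPoly R q α n m ≈ 0#
  hankel-deg≤ m N<m = trans (hankel-coeff m)
    (trans (*-congˡ (det-deg≤ N U toℕ U-deg≤ m (≡.subst (_< m) (≡.sym (sumℕ-toℕ N)) N<m))) (zeroʳ _))

  hankel-top : hankelPoly R q α n (triangle N) ≈ leadCoeff R q α n
  hankel-top = begin
    hankelPoly R q α n (triangle N)
      ≈⟨ hankel-coeff (triangle N) ⟩
    pow R q (N C 3) * DetP.det N U (triangle N)
      ≡⟨ ≡.cong (λ d → pow R q (N C 3) * DetP.det N U d) (sumℕ-toℕ N) ⟨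
    pow R q (N C 3) * DetP.det N U (sumℕ {N} toℕ)
      ≈⟨ *-congˡ (det-top N U toℕ U-deg≤) ⟩
    pow R q (N C 3) * DetR.det N (λ a j → U a j (toℕ j))
      ≈⟨ *-congˡ (DetR.det-cong N (λ a j → trans (upperFactor-top (toℕ a) (toℕ j)) (*-comm _ _))) ⟩
    pow R q (N C 3) * DetR.det N (λ a j → α (toℕ a) * pow R q (toℕ j ℕ.* toℕ a))
      ≈⟨ *-congˡ (DetR.det-row-scale N (α ∘ toℕ) (λ a j → pow R q (toℕ j ℕ.* toℕ a))) ⟩
    pow R q (N C 3) * (DetR.prodFin {N} (α ∘ toℕ) * vandermonde N)
      ≈⟨ *-congˡ (*-cong (prodFin-toℕ N α) (vandermonde-closed n)) ⟩
    pow R q (N C 3) * (prodTo R N α * (pow R (- 1#) (N C 2) * pow R q (N C 3) * staircase n))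
      ≈⟨ solve 4 (λ A B C D → (A :* (B :* ((C :* A) :* D))) := (((B :* C) :* (A :* A)) :* D)) refl _ _ _ _ ⟩
    prodTo R N α * pow R (- 1#) (N C 2) * (pow R q (N C 3) * pow R q (N C 3)) * staircase n
      ≈⟨ *-congʳ (*-congˡ (pow-double q (N C 3))) ⟨
    leadCoeff R q α n ∎
    where open import Algebra.Solver.Ring.NaturalCoefficients.Default commutativeSemiring using (solve; _:*_; _:=_)

theorem1p5 : ∀ {c ℓ : Level} (R : CommutativeRing c ℓ)
    (q : CommutativeRing.Carrier R) (α : ℕ → CommutativeRing.Carrier R) (n : ℕ) →
    (∀ m → tri R n < m →
    CommutativeRing._≈_ R (hankelPoly R q α n m) (CommutativeRing.0# R))
    × CommutativeRing._≈_ R (hankelPoly R q α n (tri R n)) (leadCoeff R q α n)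
theorem1p5 R q α n rewrite tri≡triangle R n = hankel-deg≤ , hankel-top
  where open HankelDeterminant R q α n
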